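{- Flattening and inflating are inverse operations. More precisely: \begin{enumerate}[(i)] \item if $e$ is a $k$-boundary edge of a $k$-triangulation $T$ of the $(n+1)$-gon, and $E$ denotes the $k$-crossing of $\underline{T}_e$ consisting of the edges that arise as the gluing of two edges of $T$ (namely the edges $[s_i,s_{k+i}]$, $1\le i\le k$, each obtained from $[s_{i-1},s_{k+i}]$ and $[s_i,s_{k+i}]$), then inflating $E$ at its $k$ consecutive vertices $s_1,\dots,s_k$ in $\underline{T}_e$ gives back $T$, i.e. $\overline{\underline{T}_e}^E=T$; \item if $T$ is a $k$-triangulation of the $n$-gon and $E$ is a $k$-crossing of $T$ with $k$ consecutive vertices $s_1,\ldots,s_k$, and $e$ denotes the edge $[s_0,s_k]$ of $\overline{T}^E$, then $\underline{\overline{T}^E}_e=T$. \end{enumerate}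
   Context: Vertices of a convex polygon lie on the unit circle, labelled counterclockwise; $u\prec v\prec w$ denotes counterclockwise order ($\preccurlyeq$ allows equality). Edges cross if their open segments intersect; an $\ell$-crossing is a set of $\ell$ mutually crossing edges; a $k$-triangulation is a maximal $(k+1)$-crossing-free edge set. An edge of cyclic length $k$ is a $k$-boundary edge. A $k$-star is a set of edges $\{[s_j,s_{j+k}]: j\in\mathbb{Z}_{2k+1}\}$ with $s_0\prec\dots\prec s_{2k}\prec s_0$; every $k$-boundary edge of a $k$-triangulation lies in a unique $k$-star of it. Flattening: let $T$ be a $k$-triangulation of the $(n+1)$-gon and $e=[s_0,s_0+k]$ a $k$-boundary edge of $T$; let $s_0,s_1=s_0+1,\ldots,s_k=s_0+k,s_{k+1},\ldots,s_{2k}$ be the vertices (in circle order) of the unique $k$-star of $T$ containing $e$. The flattening $\underline{T}_e$ is the edge set on the vertex set $V_{n+1}\setminus\{s_0\}$ obtained by: (i) copying every edge of $T$ with no vertex in $\{s_0,\ldots,s_k\}$; (ii) forgetting the edges $[s_0,s_i]$, $1\le i\le k$; (iii) replacing each edge $[s_i,t]$ with $0\le i\le k$ by $[s_i,t]$ if $s_k\prec t\preccurlyeq s_{k+i}$, and by $[s_{i+1},t]$ if $s_{k+i+1}\preccurlyeq t\prec s_0$. It is a $k$-triangulation of the $n$-gon. Inflating: let $T$ be a $k$-triangulation of the $n$-gon and $E$ a $k$-crossing of $T$ with edges $[s_1,s_{1+k}],\ldots,[s_k,s_{2k}]$, $s_1\prec s_2\prec\dots\prec s_{2k}$, such that $s_1,\ldots,s_k$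 are consecutive ($s_k=s_1+k-1$). Let $s_0$ be a new vertex on the circle between $s_1-1$ and $s_1$. The inflating $\overline{T}^E$ (of $E$ at $s_1,\dots,s_k$) is the edge set on $V_n\cup\{s_0\}$ obtained by: (i) copying every edge of $T$ with no vertex in $\{s_1,\ldots,s_k\}$; (ii) adding the edges $[s_0,s_i]$, $1\le i\le k$; (iii) replacing each edge $[s_i,t]$ with $1\le i\le k$ by $[s_i,t]$ if $s_k\prec t\preccurlyeq s_{k+i}$, and by $[s_{i-1},t]$ if $s_{k+i}\preccurlyeq t\prec s_1$. It is a $k$-triangulation of the $(n+1)$-gon. -}

module Defs where

open import Data.Nat using (ℕ; zero; suc; _+_; _∸_; _*_; _%_; _≤_)
open import Data.Nat.DivMod using (_mod_)
open import Data.Fin using (Fin; toℕ; punchIn; _<_)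
open import Data.Product using (Σ; ∃; ∃₂; _×_; _,_; proj₁; proj₂)
open import Data.Sum using (_⊎_)
open import Relation.Binary.PropositionalEquality using (_≡_; _≢_)
open import Relation.Nullary using (¬_)

-- Vertices of the n-gon: Fin n, labelled 0,1,…,n-1 counterclockwise.

Cyc : ∀ {n} → Fin n → Fin n → Fin n → Set
Cyc a b c = (a < b × b < c) ⊎ (b < c × c < a) ⊎ (c < a × a < b)

-- a ≺ t ≼ b   (t in the half-open arc (a,b]; empty when a = b)
OC : ∀ {n} → Fin n → Fin n → Fin n → Set
OC a t b = Cyc a t b ⊎ (t ≡ b × a ≢ b)

-- a ≼ t ≺ b   (t in the half-open arc [a,b); empty when a = b)
CO : ∀ {n} → Fin n → Fin n → Fin n → Set
CO a t b = Cyc a t b ⊎ (t ≡ a × a ≢ b)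

_⊕_ : ∀ {n} → Fin n → ℕ → Fin n
_⊕_ {suc n} a i = (toℕ a + i) mod suc n

-- Edge sets: symmetric, loopless relations; T u v means [u,v] ∈ T.

EdgeSet : ℕ → Set₁
EdgeSet n = Fin n → Fin n → Set

IsEdgeSet : ∀ {n} → EdgeSet n → Set
IsEdgeSet T = (∀ u v → T u v → T v u) × (∀ u → ¬ T u u)

_⊆E_ : ∀ {n} → EdgeSet n → EdgeSet n → Set
T ⊆E T' = ∀ u v → T u v → T' u v

Cross : ∀ {n} → Fin n × Fin n → Fin n × Fin n → Set
Cross (a , b) (c , d) = (Cyc a c b × Cyc b d a) ⊎ (Cyc b c a × Cyc a d b)

Crossing : ∀ {n} → EdgeSet n → ℕ → Set
Crossing {n} T ℓ =
  Σ (Fin ℓ → Fin n × Fin n) λ e →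
    (∀ i → T (proj₁ (e i)) (proj₂ (e i))) ×
    (∀ i j → i ≢ j → Cross (e i) (e j))

KTriangulation : ∀ {n} → ℕ → EdgeSet n → Set₁
KTriangulation {n} k T =
  IsEdgeSet T × ¬ Crossing T (suc k) ×
  (∀ (T' : EdgeSet n) → IsEdgeSet T' → ¬ Crossing T' (suc k) → T ⊆E T' → T' ⊆E T)

IsKStarOf : ∀ {n} → ℕ → EdgeSet n → (ℕ → Fin n) → Set
IsKStarOf k T s =
  (∀ i j l → i Data.Nat.< j → j Data.Nat.< l → l ≤ 2 * k → Cyc (s i) (s j) (s l)) ×
  (∀ j → j ≤ 2 * k → T (s j) (s ((j + k) % suc (2 * k))))

IsConsecKCrossingOf : ∀ {n} → ℕ → EdgeSet n → (ℕ → Fin n) → Set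
IsConsecKCrossingOf k T t =
  (∀ i j l → 1 ≤ i → i Data.Nat.< j → j Data.Nat.< l → l ≤ 2 * k → Cyc (t i) (t j) (t l)) ×
  (∀ i → 1 ≤ i → i ≤ k → T (t i) (t (k + i))) ×
  (∀ i j → 1 ≤ i → i ≤ k → 1 ≤ j → j ≤ k → i ≢ j →
     Cross (t i , t (k + i)) (t j , t (k + j))) ×
  (∀ i → 1 ≤ i → i ≤ k → t i ≡ t 1 ⊕ (i ∸ 1))

-- T on the (n+1)-gon, s the k-star (s 0 = the removed
-- vertex s₀, s i = s₀ + i for i ≤ k).  The result lives on the n-gon
-- V_{n+1} ∖ {s₀}, relabelled order-preservingly: vertex u of the n-gon
-- is the old vertex punchIn (s 0) u.

module _ {n : ℕ} (k : ℕ) (T : EdgeSet (suc n)) (s : ℕ → Fin (suc n)) where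

  private
    sw : ℕ → Fin (suc n)
    sw j = s (j % suc (2 * k))

    InS : Fin (suc n) → Set
    InS x = ∃ λ i → i ≤ k × x ≡ s i

    InS⁺ : Fin (suc n) → Set
    InS⁺ x = ∃ λ i → 1 ≤ i × i ≤ k × x ≡ s i

    -- edge [a,b] of T is sent to edge [x,y]
    FlatImg : Fin (suc n) → Fin (suc n) → Fin (suc n) → Fin (suc n) → Set
    FlatImg a b x y =
      (¬ InS a × ¬ InS b × x ≡ a × y ≡ b)
      ⊎ (InS⁺ a × InS⁺ b × x ≡ a × y ≡ b)
      ⊎ (∃ λ i → i ≤ k × a ≡ s i ×
          ((OC (s k) b (sw (k + i)) × x ≡ a × y ≡ b)
           ⊎ (CO (sw (k + i + 1)) b (s 0) × x ≡ s (i + 1) × y ≡ b)))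

    FlatOut : Fin (suc n) → Fin (suc n) → Set
    FlatOut x y = ∃₂ λ a b → T a b × (FlatImg a b x y ⊎ FlatImg a b y x)

  Flatten : EdgeSet n
  Flatten u v = FlatOut (punchIn (s 0) u) (punchIn (s 0) v)

-- Inflating.  T on the n-gon, t 1 … t (2k) the vertices of the k-crossing,
-- p : Fin (suc n) the label of the new vertex s₀ in the (n+1)-gon; the
-- old vertex u gets label punchIn p u.

module _ {n : ℕ} (k : ℕ) (T : EdgeSet n) (t : ℕ → Fin n) (p : Fin (suc n)) where

  private
    ι : Fin n → Fin (suc n)
    ι = punchIn p

    -- the vertices s₀, s₁, … in the new labelling
    ns : ℕ → Fin (suc n)
    ns zero    = p
    ns (suc j) = ι (t (suc j))

    InA : Fin n → Set
    InA x = ∃ λ i → 1 ≤ i × i ≤ k × x ≡ t i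

    InfImg : Fin n → Fin n → Fin (suc n) → Fin (suc n) → Set
    InfImg a b x y =
      (¬ InA a × ¬ InA b × x ≡ ι a × y ≡ ι b)
      ⊎ (InA a × InA b × x ≡ ι a × y ≡ ι b)
      ⊎ (∃ λ i → 1 ≤ i × i ≤ k × a ≡ t i ×
          ((OC (t k) b (t (k + i)) × x ≡ ι a × y ≡ ι b)
           ⊎ (CO (t (k + i)) b (t 1) × x ≡ ns (i ∸ 1) × y ≡ ι b)))

  Inflate : EdgeSet (suc n)
  Inflate x y =
    (∃₂ λ a b → T a b × (InfImg a b x y ⊎ InfImg a b y x))
    ⊎ (∃ λ i → 1 ≤ i × i ≤ k × ((x ≡ p × y ≡ ns i) ⊎ (y ≡ p × x ≡ ns i)))

module Submission where

-- Both parts are proved by reading every vertex through its counterclockwise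
-- offset `o x` from the distinguished vertex s₀ (the vertex that is removed by
-- flattening, resp. added by inflating).  Under this normalisation the cyclic
-- order becomes the linear order of ℕ, the arcs used in the definitions of
-- flattening and inflating become intervals of ℕ, and the star (resp. the
-- crossing) becomes an increasing sequence c 0 < c 1 < … < c 2k with
-- c i = i for i ≤ k.
--
-- Part (i) is then a case analysis matching the edges of T with
-- those of the inflated flattening; Part (ii) first shows that the star of the
-- inflated triangulation consists exactly of the vertices of the crossing
-- (`star-is-crossing`) and then does the analogous case analysis.

open import Defs
open import Data.Nat
open import Data.Nat.Properties
open import Data.Nat.DivMod
open import Data.Fin using (Fin; toℕ; punchIn; punchOut; fromℕ<)
  renaming (_<_ to _<F_; _≟_ to _≟F_)
import Data.Fin as F
open import Data.Fin.Properties
  using (toℕ<n; toℕ-fromℕ<; toℕ-injective; punchIn-injective; punchIn-mono-≤;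
         punchInᵢ≢i; punchIn-punchOut; any?; pigeonhole)
open import Data.Product
open import Data.Sum
open import Data.Empty
open import Relation.Nullary
open import Relation.Nullary.Decidable using (_×-dec_; _⊎-dec_)
open import Relation.Binary.PropositionalEquality
open import Relation.Binary.Definitions using (tri<; tri≈; tri>)
open import Relation.Binary.Structures using (IsEquivalence)
open import Function.Bundles using (_⇔_; mk⇔; Equivalence)
open import Function.Properties.Equivalence using (⇔-isEquivalence)
open import Function using (_∘_; id)

to : ∀ {A B : Set} → A ⇔ B → A → B
to = Equivalence.to

from : ∀ {A B : Set} → A ⇔ B → B → A
from = Equivalence.from

⇔-sym : ∀ {A B : Set} → A ⇔ B → B ⇔ A
⇔-sym = IsEquivalence.sym ⇔-isEquivalence

⇔-trans : ∀ {A B C : Set} → A ⇔ B → B ⇔ C → A ⇔ C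
⇔-trans = IsEquivalence.trans ⇔-isEquivalence

⇔-absurd : ∀ {A B : Set} → ¬ A → ¬ B → A ⇔ B
⇔-absurd ¬a ¬b = mk⇔ (⊥-elim ∘ ¬a) (⊥-elim ∘ ¬b)

Cycℕ : ℕ → ℕ → ℕ → Set
Cycℕ a b c = (a < b × b < c) ⊎ (b < c × c < a) ⊎ (c < a × a < b)

cyc-rotate : ∀ {a b c} → Cycℕ a b c → Cycℕ b c a
cyc-rotate (inj₁ x) = inj₂ (inj₂ x)
cyc-rotate (inj₂ (inj₁ x)) = inj₁ x
cyc-rotate (inj₂ (inj₂ x)) = inj₂ (inj₁ x)

cyc-rotate⇔ : ∀ {a b c} → Cycℕ a b c ⇔ Cycℕ b c a
cyc-rotate⇔ = mk⇔ cyc-rotate (cyc-rotate ∘ cyc-rotate)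

cyc-irrefl : ∀ {a c} → ¬ Cycℕ a a c
cyc-irrefl (inj₁ (p , _)) = <-irrefl refl p
cyc-irrefl (inj₂ (inj₁ (p , q))) = <-asym p q
cyc-irrefl (inj₂ (inj₂ (_ , p))) = <-irrefl refl p

cyc-distinct : ∀ {a b c} → Cycℕ a b c → a ≢ b × b ≢ c × c ≢ a
cyc-distinct {a} {b} {c} h =
  (λ { refl → cyc-irrefl h }) ,
  (λ { refl → cyc-irrefl (cyc-rotate h) }) ,
  (λ { refl → cyc-irrefl (cyc-rotate (cyc-rotate h)) })

cyc-suc : ∀ {a b c} → Cycℕ a b c ⇔ Cycℕ (suc a) (suc b) (suc c)
cyc-suc = mk⇔ up down
  where
  up : ∀ {a b c} → Cycℕ a b c → Cycℕ (suc a) (suc b) (suc c)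
  up (inj₁ (p , q)) = inj₁ (s<s p , s<s q)
  up (inj₂ (inj₁ (p , q))) = inj₂ (inj₁ (s<s p , s<s q))
  up (inj₂ (inj₂ (p , q))) = inj₂ (inj₂ (s<s p , s<s q))
  down : ∀ {a b c} → Cycℕ (suc a) (suc b) (suc c) → Cycℕ a b c
  down (inj₁ (s<s p , s<s q)) = inj₁ (p , q)
  down (inj₂ (inj₁ (s<s p , s<s q))) = inj₂ (inj₁ (p , q))
  down (inj₂ (inj₂ (s<s p , s<s q))) = inj₂ (inj₂ (p , q))

cyc-zero : ∀ {b c} → Cycℕ 0 b c ⇔ (0 < b × b < c)
cyc-zero = mk⇔ linear inj₁
  where
  linear : ∀ {b c} → Cycℕ 0 b c → 0 < b × b < c
  linear (inj₁ x) = x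
  linear (inj₂ (inj₁ (_ , ())))
  linear (inj₂ (inj₂ (() , _)))

cyc-linear : ∀ {a b c} → a < c → Cycℕ a b c ⇔ (a < b × b < c)
cyc-linear {a} {b} {c} a<c = mk⇔ linear inj₁
  where
  linear : Cycℕ a b c → a < b × b < c
  linear (inj₁ x) = x
  linear (inj₂ (inj₁ (_ , c<a))) = ⊥-elim (<-asym c<a a<c)
  linear (inj₂ (inj₂ (c<a , _))) = ⊥-elim (<-asym c<a a<c)

cyc-from-max : ∀ {M b c} → b < M → c < M → Cycℕ M b c ⇔ b < c
cyc-from-max {M} {b} {c} b<M c<M = mk⇔ linear (λ b<c → inj₂ (inj₁ (b<c , c<M)))
  where
  linear : Cycℕ M b c → b < c
  linear (inj₁ (M<b , _)) = ⊥-elim (<-asym M<b b<M)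
  linear (inj₂ (inj₁ (b<c , _))) = b<c
  linear (inj₂ (inj₂ (_ , M<b))) = ⊥-elim (<-asym M<b b<M)

succ-mod : (N : ℕ) .{{_ : NonZero N}} → ℕ → ℕ
succ-mod N x = suc x % N

succ-mod-cases : ∀ N .{{_ : NonZero N}} x → x < N →
  (suc x < N × succ-mod N x ≡ suc x) ⊎ (suc x ≡ N × succ-mod N x ≡ 0)
succ-mod-cases N x x<N with m≤n⇒m<n∨m≡n x<N
... | inj₁ lt = inj₁ (lt , m<n⇒m%n≡m lt)
... | inj₂ eq = inj₂ (eq , trans (cong (_% N) eq) (n%n≡0 N))

cyc-wrap : ∀ N .{{_ : NonZero N}} a b c → suc a ≡ N → suc b < N → suc c < N →
           Cycℕ a b c ⇔ Cycℕ 0 (suc b) (suc c)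
cyc-wrap N a b c refl (s<s b<a) (s<s c<a) =
  ⇔-trans (cyc-from-max b<a c<a)
    (mk⇔ (λ b<c → inj₁ (z<s , s<s b<c)) (λ h → ≤-pred (proj₂ (to cyc-zero h))))

cyc-succ-mod : ∀ N .{{_ : NonZero N}} a b c → a < N → b < N → c < N →
               Cycℕ a b c ⇔ Cycℕ (succ-mod N a) (succ-mod N b) (succ-mod N c)
cyc-succ-mod N a b c a<N b<N c<N
  with succ-mod-cases N a a<N | succ-mod-cases N b b<N | succ-mod-cases N c c<N
... | inj₁ (_ , ea) | inj₁ (_ , eb) | inj₁ (_ , ec) rewrite ea | eb | ec = cyc-suc
... | inj₂ (wa , ea) | inj₁ (lb , eb) | inj₁ (lc , ec) rewrite ea | eb | ec =
  cyc-wrap N a b c wa lb lc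
... | inj₁ (la , ea) | inj₂ (wb , eb) | inj₁ (lc , ec) rewrite ea | eb | ec =
  ⇔-trans (cyc-rotate⇔ {a}) (⇔-trans (cyc-wrap N b c a wb lc la) (⇔-sym (cyc-rotate⇔ {suc a})))
... | inj₁ (la , ea) | inj₁ (lb , eb) | inj₂ (wc , ec) rewrite ea | eb | ec =
  ⇔-trans (⇔-sym (cyc-rotate⇔ {c})) (⇔-trans (cyc-wrap N c a b wc la lb) (cyc-rotate⇔ {0}))
... | inj₂ (wa , ea) | inj₂ (wb , eb) | _ rewrite ea | eb =
  ⇔-absurd (λ h → proj₁ (cyc-distinct h) (suc-injective (trans wa (sym wb)))) cyc-irrefl
... | inj₂ (wa , ea) | inj₁ _ | inj₂ (wc , ec) rewrite ea | ec =
  ⇔-absurd (λ h → proj₂ (proj₂ (cyc-distinct h)) (suc-injective (trans wc (sym wa))))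
            (λ h → proj₂ (proj₂ (cyc-distinct h)) refl)
... | inj₁ _ | inj₂ (wb , eb) | inj₂ (wc , ec) rewrite eb | ec =
  ⇔-absurd (λ h → proj₁ (proj₂ (cyc-distinct h)) (suc-injective (trans wb (sym wc))))
            (λ h → proj₁ (proj₂ (cyc-distinct h)) refl)

rot : (N : ℕ) .{{_ : NonZero N}} → ℕ → ℕ → ℕ
rot N c x = (x + c) % N

[m%n+d]%n≡[m+d]%n : ∀ N .{{_ : NonZero N}} m d → (m % N + d) % N ≡ (m + d) % N
[m%n+d]%n≡[m+d]%n N m d = begin
  (m % N + d) % N             ≡⟨ %-distribˡ-+ (m % N) d N ⟩
  (m % N % N + d % N) % N     ≡⟨ cong (λ z → (z + d % N) % N) (m%n%n≡m%n m N) ⟩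
  (m % N + d % N) % N         ≡⟨ sym (%-distribˡ-+ m d N) ⟩
  (m + d) % N                 ∎
  where open ≡-Reasoning

rot-suc : ∀ N .{{_ : NonZero N}} c x → rot N (suc c) x ≡ succ-mod N (rot N c x)
rot-suc N c x = begin
  (x + suc c) % N       ≡⟨ cong (_% N) (trans (+-suc x c) (+-comm 1 (x + c))) ⟩
  (x + c + 1) % N       ≡⟨ sym ([m%n+d]%n≡[m+d]%n N (x + c) 1) ⟩
  ((x + c) % N + 1) % N ≡⟨ cong (_% N) (+-comm ((x + c) % N) 1) ⟩
  suc ((x + c) % N) % N ∎
  where open ≡-Reasoning

rot-rot : ∀ N .{{_ : NonZero N}} c d x → rot N d (rot N c x) ≡ rot N (c + d) x
rot-rot N c d x = trans ([m%n+d]%n≡[m+d]%n N (x + c) d) (cong (_% N) (+-assoc x c d))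

cyc-rot : ∀ N .{{_ : NonZero N}} c a b d → a < N → b < N → d < N →
          Cycℕ a b d ⇔ Cycℕ (rot N c a) (rot N c b) (rot N c d)
cyc-rot N zero a b d a<N b<N d<N
  rewrite +-identityʳ a | +-identityʳ b | +-identityʳ d
        | m<n⇒m%n≡m a<N | m<n⇒m%n≡m b<N | m<n⇒m%n≡m d<N = mk⇔ id id
cyc-rot N (suc c) a b d a<N b<N d<N rewrite rot-suc N c a | rot-suc N c b | rot-suc N c d =
  ⇔-trans (cyc-rot N c a b d a<N b<N d<N)
          (cyc-succ-mod N _ _ _ (m%n<n (a + c) N) (m%n<n (b + c) N) (m%n<n (d + c) N))

OCℕ : ℕ → ℕ → ℕ → Set
OCℕ a t b = Cycℕ a t b ⊎ (t ≡ b × a ≢ b)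

COℕ : ℕ → ℕ → ℕ → Set
COℕ a t b = Cycℕ a t b ⊎ (t ≡ a × a ≢ b)

oc-empty : ∀ {a t} → ¬ OCℕ a t a
oc-empty (inj₁ c) = cyc-irrefl (cyc-rotate (cyc-rotate c))
oc-empty (inj₂ (_ , a≢a)) = a≢a refl

co-empty : ∀ {a t} → ¬ COℕ a t a
co-empty (inj₁ c) = cyc-irrefl (cyc-rotate (cyc-rotate c))
co-empty (inj₂ (_ , a≢a)) = a≢a refl

oc-interval : ∀ {a t b} → a < b → OCℕ a t b ⇔ (a < t × t ≤ b)
oc-interval {a} {t} {b} a<b = mk⇔ interval arc
  where
  interval : OCℕ a t b → a < t × t ≤ b
  interval (inj₁ c) = let (p , q) = to (cyc-linear a<b) c in p , <⇒≤ q
  interval (inj₂ (refl , _)) = a<b , ≤-refl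
  arc : a < t × t ≤ b → OCℕ a t b
  arc (p , q) with m≤n⇒m<n∨m≡n q
  ... | inj₁ lt = inj₁ (inj₁ (p , lt))
  ... | inj₂ eq = inj₂ (eq , <⇒≢ a<b)

co-tail : ∀ {a t} → 1 < a → 1 ≤ t → COℕ a t 1 ⇔ a ≤ t
co-tail {a} {t} 1<a 1≤t = mk⇔ interval arc
  where
  interval : COℕ a t 1 → a ≤ t
  interval (inj₁ (inj₁ (_ , t<1))) = ⊥-elim (<-irrefl refl (≤-trans t<1 1≤t))
  interval (inj₁ (inj₂ (inj₁ (t<1 , _)))) = ⊥-elim (<-irrefl refl (≤-trans t<1 1≤t))
  interval (inj₁ (inj₂ (inj₂ (_ , a<t)))) = <⇒≤ a<t
  interval (inj₂ (refl , _)) = ≤-refl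
  arc : a ≤ t → COℕ a t 1
  arc q with m≤n⇒m<n∨m≡n q
  ... | inj₁ lt = inj₁ (inj₂ (inj₂ (1<a , lt)))
  ... | inj₂ eq = inj₂ (sym eq , (λ e → <-irrefl (sym e) 1<a))

co-tail₀ : ∀ {a t} → COℕ a t 0 ⇔ (0 < a × a ≤ t)
co-tail₀ {a} {t} = mk⇔ interval arc
  where
  interval : COℕ a t 0 → 0 < a × a ≤ t
  interval (inj₁ c) = let (p , q) = to cyc-zero (cyc-rotate (cyc-rotate c)) in p , <⇒≤ q
  interval (inj₂ (refl , a≢0)) = n≢0⇒n>0 a≢0 , ≤-refl
  arc : 0 < a × a ≤ t → COℕ a t 0
  arc (p , q) with m≤n⇒m<n∨m≡n q
  ... | inj₁ lt = inj₁ (inj₂ (inj₂ (p , lt)))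
  ... | inj₂ eq = inj₂ (sym eq , (λ e → <-irrefl (sym e) p))

-- For a base vertex z of the N-gon, o x is the counterclockwise
-- distance from z to x.
module Offset {n : ℕ} (z : Fin (suc n)) where
  N : ℕ
  N = suc n

  o : Fin N → ℕ
  o x = rot N (N ∸ toℕ z) (toℕ x)

  o<N : ∀ x → o x < N
  o<N x = m%n<n (toℕ x + (N ∸ toℕ z)) N

  o-back : ∀ x → rot N (toℕ z) (o x) ≡ toℕ x
  o-back x = begin
    rot N (toℕ z) (o x)                ≡⟨ rot-rot N (N ∸ toℕ z) (toℕ z) (toℕ x) ⟩
    (toℕ x + (N ∸ toℕ z + toℕ z)) % N  ≡⟨ cong (λ w → (toℕ x + w) % N) (m∸n+n≡m (<⇒≤ (toℕ<n z))) ⟩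
    (toℕ x + N) % N                    ≡⟨ [m+n]%n≡m%n (toℕ x) N ⟩
    toℕ x % N                          ≡⟨ m<n⇒m%n≡m (toℕ<n x) ⟩
    toℕ x                              ∎
    where open ≡-Reasoning

  o-inj : ∀ {x y} → o x ≡ o y → x ≡ y
  o-inj {x} {y} e = toℕ-injective (trans (sym (o-back x)) (trans (cong (rot N (toℕ z)) e) (o-back y)))

  o-self : o z ≡ 0
  o-self = trans (cong (_% N) (m+[n∸m]≡n (<⇒≤ (toℕ<n z)))) (n%n≡0 N)

  ≢base : ∀ x → 0 < o x → x ≢ z
  ≢base x 0<x refl = <-irrefl (sym o-self) 0<x

  o-⊕ : ∀ i → i < N → o (z ⊕ i) ≡ i
  o-⊕ i i<N = begin
    (toℕ (z ⊕ i) + (N ∸ toℕ z)) % N     ≡⟨ cong (λ w → (w + (N ∸ toℕ z)) % N) (toℕ-fromℕ< (m%n<n (toℕ z + i) N)) ⟩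
    ((toℕ z + i) % N + (N ∸ toℕ z)) % N ≡⟨ [m%n+d]%n≡[m+d]%n N (toℕ z + i) (N ∸ toℕ z) ⟩
    (toℕ z + i + (N ∸ toℕ z)) % N       ≡⟨ cong (_% N) (regroup (toℕ z) (<⇒≤ (toℕ<n z))) ⟩
    (i + N) % N                         ≡⟨ [m+n]%n≡m%n i N ⟩
    i % N                               ≡⟨ m<n⇒m%n≡m i<N ⟩
    i                                   ∎
    where
    open ≡-Reasoning
    regroup : ∀ a → a ≤ N → a + i + (N ∸ a) ≡ i + N
    regroup a a≤N = begin
      a + i + (N ∸ a)   ≡⟨ cong (_+ (N ∸ a)) (+-comm a i) ⟩
      i + a + (N ∸ a)   ≡⟨ +-assoc i a (N ∸ a) ⟩
      i + (a + (N ∸ a)) ≡⟨ cong (i +_) (m+[n∸m]≡n a≤N) ⟩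
      i + N             ∎

  cycO : ∀ a b c → Cyc a b c ⇔ Cycℕ (o a) (o b) (o c)
  cycO a b c = cyc-rot N (N ∸ toℕ z) (toℕ a) (toℕ b) (toℕ c) (toℕ<n a) (toℕ<n b) (toℕ<n c)

  ocO : ∀ a t b → OC a t b ⇔ OCℕ (o a) (o t) (o b)
  ocO a t b = mk⇔ there back
    where
    there : OC a t b → OCℕ (o a) (o t) (o b)
    there (inj₁ c) = inj₁ (to (cycO a t b) c)
    there (inj₂ (e , ne)) = inj₂ (cong o e , ne ∘ o-inj)
    back : OCℕ (o a) (o t) (o b) → OC a t b
    back (inj₁ c) = inj₁ (from (cycO a t b) c)
    back (inj₂ (e , ne)) = inj₂ (o-inj e , ne ∘ cong o)

  coO : ∀ a t b → CO a t b ⇔ COℕ (o a) (o t) (o b)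
  coO a t b = mk⇔ there back
    where
    there : CO a t b → COℕ (o a) (o t) (o b)
    there (inj₁ c) = inj₁ (to (cycO a t b) c)
    there (inj₂ (e , ne)) = inj₂ (cong o e , ne ∘ o-inj)
    back : COℕ (o a) (o t) (o b) → CO a t b
    back (inj₁ c) = inj₁ (from (cycO a t b) c)
    back (inj₂ (e , ne)) = inj₂ (o-inj e , ne ∘ cong o)

  cross-alternating : ∀ a b c d → o a < o c → o c < o b → o b < o d → Cross (a , b) (c , d)
  cross-alternating a b c d ac cb bd =
    inj₁ (from (cycO a c b) (inj₁ (ac , cb)) , from (cycO b d a) (inj₂ (inj₂ (<-trans ac cb , bd))))

  cross-alternating′ : ∀ a b c d → o c < o a → o a < o d → o d < o b → Cross (a , b) (c , d)
  cross-alternating′ a b c d ca ad db =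
    inj₂ (from (cycO b c a) (inj₂ (inj₁ (ca , <-trans ad db))) , from (cycO a d b) (inj₁ (ad , db)))

module PunchIn {n : ℕ} (σ : Fin (suc n)) where
  ι : Fin n → Fin (suc n)
  ι = punchIn σ

  ι-inj : ∀ {a b} → ι a ≡ ι b → a ≡ b
  ι-inj {a} {b} = punchIn-injective σ a b

  ι≢σ : ∀ a → ι a ≢ σ
  ι≢σ a = punchInᵢ≢i σ a

  ι-surj : ∀ x → x ≢ σ → Σ (Fin n) λ a → ι a ≡ x
  ι-surj x ne = punchOut (ne ∘ sym) , punchIn-punchOut (ne ∘ sym)

  ι-mono : ∀ {a b} → a <F b → ι a <F ι b
  ι-mono {a} {b} a<b with m≤n⇒m<n∨m≡n (punchIn-mono-≤ σ a b (<⇒≤ a<b))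
  ... | inj₁ lt = lt
  ... | inj₂ eq = ⊥-elim (<-irrefl (cong toℕ (ι-inj (toℕ-injective eq))) a<b)

  ι-reflect : ∀ {a b} → ι a <F ι b → a <F b
  ι-reflect {a} {b} h with <-cmp (toℕ a) (toℕ b)
  ... | tri< p _ _ = p
  ... | tri≈ _ e _ = ⊥-elim (<-irrefl (cong (toℕ ∘ ι) (toℕ-injective e)) h)
  ... | tri> _ _ p = ⊥-elim (<⇒≱ h (punchIn-mono-≤ σ b a (<⇒≤ p)))

  cycI : ∀ a b c → Cyc a b c ⇔ Cyc (ι a) (ι b) (ι c)
  cycI a b c = mk⇔ there back
    where
    there : Cyc a b c → Cyc (ι a) (ι b) (ι c)
    there (inj₁ (p , q)) = inj₁ (ι-mono p , ι-mono q)
    there (inj₂ (inj₁ (p , q))) = inj₂ (inj₁ (ι-mono p , ι-mono q))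
    there (inj₂ (inj₂ (p , q))) = inj₂ (inj₂ (ι-mono p , ι-mono q))
    back : Cyc (ι a) (ι b) (ι c) → Cyc a b c
    back (inj₁ (p , q)) = inj₁ (ι-reflect p , ι-reflect q)
    back (inj₂ (inj₁ (p , q))) = inj₂ (inj₁ (ι-reflect p , ι-reflect q))
    back (inj₂ (inj₂ (p , q))) = inj₂ (inj₂ (ι-reflect p , ι-reflect q))

  ocI : ∀ a t b → OC a t b ⇔ OC (ι a) (ι t) (ι b)
  ocI a t b = mk⇔ there back
    where
    there : OC a t b → OC (ι a) (ι t) (ι b)
    there (inj₁ c) = inj₁ (to (cycI a t b) c)
    there (inj₂ (e , ne)) = inj₂ (cong ι e , ne ∘ ι-inj)
    back : OC (ι a) (ι t) (ι b) → OC a t b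
    back (inj₁ c) = inj₁ (from (cycI a t b) c)
    back (inj₂ (e , ne)) = inj₂ (ι-inj e , ne ∘ cong ι)

  coI : ∀ a t b → CO a t b ⇔ CO (ι a) (ι t) (ι b)
  coI a t b = mk⇔ there back
    where
    there : CO a t b → CO (ι a) (ι t) (ι b)
    there (inj₁ c) = inj₁ (to (cycI a t b) c)
    there (inj₂ (e , ne)) = inj₂ (cong ι e , ne ∘ ι-inj)
    back : CO (ι a) (ι t) (ι b) → CO a t b
    back (inj₁ c) = inj₁ (from (cycI a t b) c)
    back (inj₂ (e , ne)) = inj₂ (ι-inj e , ne ∘ cong ι)

⊕-suc : ∀ {m} (a : Fin m) i → (a ⊕ i) ⊕ 1 ≡ a ⊕ suc i
⊕-suc {suc m} a i = toℕ-injective (begin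
  toℕ ((a ⊕ i) ⊕ 1)           ≡⟨ toℕ-fromℕ< (m%n<n (toℕ (a ⊕ i) + 1) (suc m)) ⟩
  (toℕ (a ⊕ i) + 1) % suc m   ≡⟨ cong (λ w → (w + 1) % suc m) (toℕ-fromℕ< (m%n<n (toℕ a + i) (suc m))) ⟩
  ((toℕ a + i) % suc m + 1) % suc m ≡⟨ [m%n+d]%n≡[m+d]%n (suc m) (toℕ a + i) 1 ⟩
  (toℕ a + i + 1) % suc m     ≡⟨ cong (_% suc m) (trans (+-assoc (toℕ a) i 1) (cong (toℕ a +_) (+-comm i 1))) ⟩
  (toℕ a + suc i) % suc m     ≡⟨ sym (toℕ-fromℕ< (m%n<n (toℕ a + suc i) (suc m))) ⟩
  toℕ (a ⊕ suc i)             ∎)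
  where open ≡-Reasoning

nothing-between-neighbours : ∀ {m} (a x : Fin m) → ¬ Cyc a x (a ⊕ 1)
nothing-between-neighbours {suc zero} F.zero F.zero cy = cyc-irrefl cy
nothing-between-neighbours {suc (suc m)} a x cy = <-irrefl refl (<-≤-trans (proj₂ r) (proj₁ r))
  where
  open Offset a
  r : 0 < o x × o x < 1
  r = to cyc-zero (subst₂ (λ u w → Cycℕ u (o x) w) o-self (o-⊕ 1 (s≤s (s≤s z≤n))) (to (cycO a x (a ⊕ 1)) cy))

module LiftedArcs {n : ℕ} (σ : Fin (suc n)) where
  open Offset σ
  open PunchIn σ

  1≤o[ι] : ∀ u → 1 ≤ o (ι u)
  1≤o[ι] u = n≢0⇒n>0 (λ e → ι≢σ u (o-inj (trans e (sym o-self))))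

  oc-lifted : ∀ a x b → o (ι a) < o (ι b) → OC a x b ⇔ (o (ι a) < o (ι x) × o (ι x) ≤ o (ι b))
  oc-lifted a x b a<b = ⇔-trans (ocI a x b) (⇔-trans (ocO (ι a) (ι x) (ι b)) (oc-interval a<b))

  co-lifted : ∀ a x b → o (ι b) ≡ 1 → 1 < o (ι a) → CO a x b ⇔ o (ι a) ≤ o (ι x)
  co-lifted a x b b≡1 1<a = ⇔-trans (coI a x b) (⇔-trans (coO (ι a) (ι x) (ι b))
    (subst (λ w → COℕ (o (ι a)) (o (ι x)) w ⇔ o (ι a) ≤ o (ι x)) (sym b≡1) (co-tail 1<a (1≤o[ι] x))))

-- Flatten and Inflate, with their (private) auxiliary notions restated
-- verbatim so that the case analyses below can refer to them.  `Flatten`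
-- unfolds definitionally to `FlatOut`.
module FlattenCases {n : ℕ} (k : ℕ) (T : EdgeSet (suc n)) (s : ℕ → Fin (suc n)) where
  sw : ℕ → Fin (suc n)
  sw j = s (j % suc (2 * k))

  InS : Fin (suc n) → Set
  InS x = ∃ λ i → i ≤ k × x ≡ s i

  InS⁺ : Fin (suc n) → Set
  InS⁺ x = ∃ λ i → 1 ≤ i × i ≤ k × x ≡ s i

  FlatImg : Fin (suc n) → Fin (suc n) → Fin (suc n) → Fin (suc n) → Set
  FlatImg a b x y =
    (¬ InS a × ¬ InS b × x ≡ a × y ≡ b)
    ⊎ (InS⁺ a × InS⁺ b × x ≡ a × y ≡ b)
    ⊎ (∃ λ i → i ≤ k × a ≡ s i ×
        ((OC (s k) b (sw (k + i)) × x ≡ a × y ≡ b)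
         ⊎ (CO (sw (k + i + 1)) b (s 0) × x ≡ s (i + 1) × y ≡ b)))

  FlatOut : Fin (suc n) → Fin (suc n) → Set
  FlatOut x y = ∃₂ λ a b → T a b × (FlatImg a b x y ⊎ FlatImg a b y x)

  flat-sym : ∀ x y → FlatOut x y → FlatOut y x
  flat-sym x y (a , b , tab , inj₁ im) = a , b , tab , inj₂ im
  flat-sym x y (a , b , tab , inj₂ im) = a , b , tab , inj₁ im

-- For Inflate the restated `ns` is a different (recursive) function from the
-- private one, so the two descriptions agree only after splitting the index
-- i into 1 and 2+ (where both reduce); `inflate→cases` and `cases→inflate`
-- perform exactly this split.
module InflateCases {n : ℕ} (k : ℕ) (T : EdgeSet n) (t : ℕ → Fin n) (p : Fin (suc n)) where
  ns : ℕ → Fin (suc n)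
  ns zero    = p
  ns (suc j) = punchIn p (t (suc j))

  InA : Fin n → Set
  InA x = ∃ λ i → 1 ≤ i × i ≤ k × x ≡ t i

  InfImg : Fin n → Fin n → Fin (suc n) → Fin (suc n) → Set
  InfImg a b x y =
    (¬ InA a × ¬ InA b × x ≡ punchIn p a × y ≡ punchIn p b)
    ⊎ (InA a × InA b × x ≡ punchIn p a × y ≡ punchIn p b)
    ⊎ (∃ λ i → 1 ≤ i × i ≤ k × a ≡ t i ×
        ((OC (t k) b (t (k + i)) × x ≡ punchIn p a × y ≡ punchIn p b)
         ⊎ (CO (t (k + i)) b (t 1) × x ≡ ns (i ∸ 1) × y ≡ punchIn p b)))

  InflC : Fin (suc n) → Fin (suc n) → Set
  InflC x y = (∃₂ λ a b → T a b × (InfImg a b x y ⊎ InfImg a b y x))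
    ⊎ (∃ λ i → 1 ≤ i × i ≤ k × ((x ≡ p × y ≡ ns i) ⊎ (y ≡ p × x ≡ ns i)))

  inflate→cases : ∀ x y → Inflate k T t p x y → InflC x y
  inflate→cases x y (inj₁ (a , b , tab , inj₁ (inj₁ q))) = inj₁ (a , b , tab , inj₁ (inj₁ q))
  inflate→cases x y (inj₁ (a , b , tab , inj₁ (inj₂ (inj₁ q)))) = inj₁ (a , b , tab , inj₁ (inj₂ (inj₁ q)))
  inflate→cases x y (inj₁ (a , b , tab , inj₁ (inj₂ (inj₂ (i , q₁ , q₂ , q₃ , inj₁ r))))) = inj₁ (a , b , tab , inj₁ (inj₂ (inj₂ (i , q₁ , q₂ , q₃ , inj₁ r))))
  inflate→cases x y (inj₁ (a , b , tab , inj₁ (inj₂ (inj₂ (1 , q₁ , q₂ , q₃ , inj₂ r))))) = inj₁ (a , b , tab , inj₁ (inj₂ (inj₂ (1 , q₁ , q₂ , q₃ , inj₂ r))))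
  inflate→cases x y (inj₁ (a , b , tab , inj₁ (inj₂ (inj₂ (suc (suc j) , q₁ , q₂ , q₃ , inj₂ r))))) = inj₁ (a , b , tab , inj₁ (inj₂ (inj₂ (suc (suc j) , q₁ , q₂ , q₃ , inj₂ r))))
  inflate→cases x y (inj₁ (a , b , tab , inj₂ (inj₁ q))) = inj₁ (a , b , tab , inj₂ (inj₁ q))
  inflate→cases x y (inj₁ (a , b , tab , inj₂ (inj₂ (inj₁ q)))) = inj₁ (a , b , tab , inj₂ (inj₂ (inj₁ q)))
  inflate→cases x y (inj₁ (a , b , tab , inj₂ (inj₂ (inj₂ (i , q₁ , q₂ , q₃ , inj₁ r))))) = inj₁ (a , b , tab , inj₂ (inj₂ (inj₂ (i , q₁ , q₂ , q₃ , inj₁ r))))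
  inflate→cases x y (inj₁ (a , b , tab , inj₂ (inj₂ (inj₂ (1 , q₁ , q₂ , q₃ , inj₂ r))))) = inj₁ (a , b , tab , inj₂ (inj₂ (inj₂ (1 , q₁ , q₂ , q₃ , inj₂ r))))
  inflate→cases x y (inj₁ (a , b , tab , inj₂ (inj₂ (inj₂ (suc (suc j) , q₁ , q₂ , q₃ , inj₂ r))))) = inj₁ (a , b , tab , inj₂ (inj₂ (inj₂ (suc (suc j) , q₁ , q₂ , q₃ , inj₂ r))))
  inflate→cases x y (inj₂ (suc i , q)) = inj₂ (suc i , q)

  cases→inflate : ∀ x y → InflC x y → Inflate k T t p x y
  cases→inflate x y (inj₁ (a , b , tab , inj₁ (inj₁ q))) = inj₁ (a , b , tab , inj₁ (inj₁ q))
  cases→inflate x y (inj₁ (a , b , tab , inj₁ (inj₂ (inj₁ q)))) = inj₁ (a , b , tab , inj₁ (inj₂ (inj₁ q)))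
  cases→inflate x y (inj₁ (a , b , tab , inj₁ (inj₂ (inj₂ (i , q₁ , q₂ , q₃ , inj₁ r))))) = inj₁ (a , b , tab , inj₁ (inj₂ (inj₂ (i , q₁ , q₂ , q₃ , inj₁ r))))
  cases→inflate x y (inj₁ (a , b , tab , inj₁ (inj₂ (inj₂ (1 , q₁ , q₂ , q₃ , inj₂ r))))) = inj₁ (a , b , tab , inj₁ (inj₂ (inj₂ (1 , q₁ , q₂ , q₃ , inj₂ r))))
  cases→inflate x y (inj₁ (a , b , tab , inj₁ (inj₂ (inj₂ (suc (suc j) , q₁ , q₂ , q₃ , inj₂ r))))) = inj₁ (a , b , tab , inj₁ (inj₂ (inj₂ (suc (suc j) , q₁ , q₂ , q₃ , inj₂ r))))
  cases→inflate x y (inj₁ (a , b , tab , inj₂ (inj₁ q))) = inj₁ (a , b , tab , inj₂ (inj₁ q))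
  cases→inflate x y (inj₁ (a , b , tab , inj₂ (inj₂ (inj₁ q)))) = inj₁ (a , b , tab , inj₂ (inj₂ (inj₁ q)))
  cases→inflate x y (inj₁ (a , b , tab , inj₂ (inj₂ (inj₂ (i , q₁ , q₂ , q₃ , inj₁ r))))) = inj₁ (a , b , tab , inj₂ (inj₂ (inj₂ (i , q₁ , q₂ , q₃ , inj₁ r))))
  cases→inflate x y (inj₁ (a , b , tab , inj₂ (inj₂ (inj₂ (1 , q₁ , q₂ , q₃ , inj₂ r))))) = inj₁ (a , b , tab , inj₂ (inj₂ (inj₂ (1 , q₁ , q₂ , q₃ , inj₂ r))))
  cases→inflate x y (inj₁ (a , b , tab , inj₂ (inj₂ (inj₂ (suc (suc j) , q₁ , q₂ , q₃ , inj₂ r))))) = inj₁ (a , b , tab , inj₂ (inj₂ (inj₂ (suc (suc j) , q₁ , q₂ , q₃ , inj₂ r))))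
  cases→inflate x y (inj₂ (suc i , q)) = inj₂ (suc i , q)

  inflC-sym : ∀ x y → InflC x y → InflC y x
  inflC-sym x y (inj₁ (a , b , tab , inj₁ im)) = inj₁ (a , b , tab , inj₂ im)
  inflC-sym x y (inj₁ (a , b , tab , inj₂ im)) = inj₁ (a , b , tab , inj₁ im)
  inflC-sym x y (inj₂ (i , 1≤i , i≤k , inj₁ q)) = inj₂ (i , 1≤i , i≤k , inj₂ q)
  inflC-sym x y (inj₂ (i , 1≤i , i≤k , inj₂ q)) = inj₂ (i , 1≤i , i≤k , inj₁ q)

k+i≤2k : ∀ k i → i ≤ k → k + i ≤ 2 * k
k+i≤2k k i i≤k = subst (k + i ≤_) (cong (k +_) (sym (+-identityʳ k))) (+-monoʳ-≤ k i≤k)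

k≤2k : ∀ k → k ≤ 2 * k
k≤2k k = m≤m+n k (k + 0)

[k+i]%[2k+1]≡k+i : ∀ k i → i ≤ k → (k + i) % suc (2 * k) ≡ k + i
[k+i]%[2k+1]≡k+i k i i≤k = m<n⇒m%n≡m (s≤s (k+i≤2k k i i≤k))

k+i+1≡k+[1+i] : ∀ k i → k + i + 1 ≡ k + suc i
k+i+1≡k+[1+i] k i = trans (+-assoc k i 1) (cong (k +_) (+-comm i 1))

[k+k+1]%[2k+1]≡0 : ∀ k → (k + k + 1) % suc (2 * k) ≡ 0
[k+k+1]%[2k+1]≡0 k = trans (cong (_% suc (2 * k)) k+k+1≡2k+1) (n%n≡0 (suc (2 * k)))
  where
  k+k+1≡2k+1 : k + k + 1 ≡ suc (2 * k)
  k+k+1≡2k+1 = trans (+-comm (k + k) 1) (cong (λ w → suc (k + w)) (sym (+-identityʳ k)))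

-- The partner of s (k+1+i) in the star is s i.
[k+[1+i]+k]%[2k+1]≡i : ∀ k i → i ≤ k → (k + suc i + k) % suc (2 * k) ≡ i
[k+[1+i]+k]%[2k+1]≡i k i i≤k =
  trans (cong (_% suc (2 * k)) regroup)
    (trans ([m+n]%n≡m%n i (suc (2 * k))) (m<n⇒m%n≡m (≤-<-trans i≤k (s≤s (k≤2k k)))))
  where
  regroup : k + suc i + k ≡ i + suc (2 * k)
  regroup = begin
    k + suc i + k       ≡⟨ cong (_+ k) (+-suc k i) ⟩
    suc (k + i) + k     ≡⟨ cong (λ w → suc w + k) (+-comm k i) ⟩
    suc (i + k + k)     ≡⟨ cong suc (+-assoc i k k) ⟩
    suc (i + (k + k))   ≡⟨ sym (+-suc i (k + k)) ⟩
    i + suc (k + k)     ≡⟨ cong (λ w → i + suc (k + w)) (sym (+-identityʳ k)) ⟩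
    i + suc (2 * k)     ∎
    where open ≡-Reasoning

star-edge : ∀ {n} k (T : EdgeSet n) (s : ℕ → Fin n) → IsKStarOf k T s →
            ∀ i → i ≤ k → T (s i) (s (k + i))
star-edge k T s star i i≤k = subst (λ w → T (s i) (s w)) ([k+i]%[2k+1]≡k+i k i i≤k)
  (subst (λ w → T (s i) (s (w % suc (2 * k)))) (+-comm i k) (proj₂ star i (≤-trans i≤k (k≤2k k))))

star-edge′ : ∀ {n} k (T : EdgeSet n) (s : ℕ → Fin n) → IsKStarOf k T s → (∀ u v → T u v → T v u) →
             ∀ i → i < k → T (s i) (s (k + suc i))
star-edge′ k T s star T-sym i i<k =
  T-sym _ _ (subst (λ w → T (s (k + suc i)) (s w)) ([k+[1+i]+k]%[2k+1]≡i k i (<⇒≤ i<k))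
    (proj₂ star (k + suc i) (k+i≤2k k (suc i) i<k)))

increasing-gap : (c : ℕ → ℕ) (M : ℕ) → (∀ i j → i < j → j ≤ M → c i < c j) →
                 ∀ i d → i + d ≤ M → c i + d ≤ c (i + d)
increasing-gap c M inc i zero _ =
  ≤-reflexive (trans (+-identityʳ (c i)) (cong c (sym (+-identityʳ i))))
increasing-gap c M inc i (suc d) i+d<M = begin
  c i + suc d       ≡⟨ +-suc (c i) d ⟩
  suc (c i + d)     ≤⟨ s≤s (increasing-gap c M inc i d (≤-trans (+-monoʳ-≤ i (n≤1+n d)) i+d<M)) ⟩
  suc (c (i + d))   ≤⟨ inc (i + d) (i + suc d) (≤-reflexive (sym (+-suc i d))) i+d<M ⟩
  c (i + suc d)     ∎
  where open ≤-Reasoning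

module StarOffsets {n : ℕ} (k : ℕ) (1≤k : 1 ≤ k) (s : ℕ → Fin (suc n)) (z : Fin (suc n)) (s0≡z : s 0 ≡ z)
  (ordered : ∀ i j l → i < j → j < l → l ≤ 2 * k → Cyc (s i) (s j) (s l)) where
  open Offset z

  c : ℕ → ℕ
  c j = o (s j)

  c0 : c 0 ≡ 0
  c0 = trans (cong o s0≡z) o-self

  private
    1<2k : 1 < 2 * k
    1<2k = +-mono-≤ 1≤k (≤-trans 1≤k (≤-reflexive (sym (+-identityʳ k))))

    c-between : ∀ i j → 1 ≤ i → i < j → j ≤ 2 * k → 0 < c i × c i < c j
    c-between i j 1≤i i<j j≤2k =
      to cyc-zero (subst (λ w → Cycℕ w (c i) (c j)) c0 (to (cycO (s 0) (s i) (s j)) (ordered 0 i j 1≤i i<j j≤2k)))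

    c-pos : ∀ j → 1 ≤ j → j ≤ 2 * k → 0 < c j
    c-pos j 1≤j j≤2k with m≤n⇒m<n∨m≡n j≤2k
    ... | inj₁ j<2k = proj₁ (c-between j (2 * k) 1≤j j<2k ≤-refl)
    ... | inj₂ refl = let (p , q) = c-between 1 (2 * k) ≤-refl 1<2k ≤-refl in <-trans p q

  c-inc : ∀ i j → i < j → j ≤ 2 * k → c i < c j
  c-inc zero j 0<j j≤2k = subst (_< c j) (sym c0) (c-pos j 0<j j≤2k)
  c-inc (suc i) j i<j j≤2k = proj₂ (c-between (suc i) j (s≤s z≤n) i<j j≤2k)

  c-mono : ∀ i j → i ≤ j → j ≤ 2 * k → c i ≤ c j
  c-mono i j i≤j j≤2k with m≤n⇒m<n∨m≡n i≤j
  ... | inj₁ i<j = <⇒≤ (c-inc i j i<j j≤2k)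
  ... | inj₂ refl = ≤-refl

  c-gap : ∀ i d → i + d ≤ 2 * k → c i + d ≤ c (i + d)
  c-gap = increasing-gap c (2 * k) c-inc

  k≤ck : k ≤ c k
  k≤ck = subst (λ w → w + k ≤ c k) c0 (c-gap 0 k (k≤2k k))

  consecutive : c k ≡ k → ∀ i → i ≤ k → c i ≡ i
  consecutive ck≡k i i≤k = ≤-antisym above below
    where
    below : i ≤ c i
    below = subst (λ w → w + i ≤ c i) c0 (c-gap 0 i (≤-trans i≤k (k≤2k k)))
    above : c i ≤ i
    above = +-cancelʳ-≤ (k ∸ i) (c i) i (begin
      c i + (k ∸ i)      ≤⟨ c-gap i (k ∸ i) (≤-trans (≤-reflexive (m+[n∸m]≡n i≤k)) (k≤2k k)) ⟩
      c (i + (k ∸ i))    ≡⟨ cong c (m+[n∸m]≡n i≤k) ⟩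
      c k                ≡⟨ ck≡k ⟩
      k                  ≡⟨ sym (m+[n∸m]≡n i≤k) ⟩
      i + (k ∸ i)        ∎)
      where open ≤-Reasoning

-- Every edge of the
-- flattening is of one of four kinds (`FlatEdge`): an edge of T away from
-- s 0 … s k, an edge of T among s 1 … s k, an edge [s i, Y] of T that is kept
-- because Y ∈ (s k, s (k+i)], or the edge [s (i+1), Y] obtained by shifting
-- an edge [s i, Y] of T with Y ∈ [s (k+i+1), s 0).
module FlattenDescription {n : ℕ} (k : ℕ) (T : EdgeSet (suc n)) (s : ℕ → Fin (suc n)) (z : Fin (suc n))
  (c-init : ∀ i → i ≤ k → Offset.o z (s i) ≡ i)
  (c-inc : ∀ i j → i < j → j ≤ 2 * k → Offset.o z (s i) < Offset.o z (s j)) where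
  open Offset z
  open FlattenCases k T s

  c : ℕ → ℕ
  c j = o (s j)

  star-at-offset : ∀ x → o x ≤ k → x ≡ s (o x)
  star-at-offset x h = o-inj (sym (c-init (o x) h))

  sw-k+i : ∀ i → i ≤ k → sw (k + i) ≡ s (k + i)
  sw-k+i i i≤k = cong s ([k+i]%[2k+1]≡k+i k i i≤k)

  sw-k+i+1 : ∀ i → i < k → sw (k + i + 1) ≡ s (k + suc i)
  sw-k+i+1 i i<k = cong s (trans (cong (_% suc (2 * k)) (k+i+1≡k+[1+i] k i)) ([k+i]%[2k+1]≡k+i k (suc i) i<k))

  sw-k+k+1 : sw (k + k + 1) ≡ s 0
  sw-k+k+1 = cong s ([k+k+1]%[2k+1]≡0 k)

  k<c[k+i] : ∀ i → 1 ≤ i → i ≤ k → k < c (k + i)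
  k<c[k+i] i 1≤i i≤k = subst (_< c (k + i)) (c-init k ≤-refl)
    (c-inc k (k + i) (subst (_≤ k + i) (+-comm k 1) (+-monoʳ-≤ k 1≤i)) (k+i≤2k k i i≤k))

  Kept Shifted : Fin (suc n) → Fin (suc n) → Set
  Kept X Y = Σ ℕ λ i → 1 ≤ i × i ≤ k × X ≡ s i × k < o Y × o Y ≤ c (k + i) × T X Y
  Shifted X Y = Σ ℕ λ i → i < k × X ≡ s (suc i) × c (k + suc i) ≤ o Y × T (s i) Y

  FlatEdge : Fin (suc n) → Fin (suc n) → Set
  FlatEdge X Y =
    (T X Y × k < o X × k < o Y)
    ⊎ (T X Y × 1 ≤ o X × o X ≤ k × 1 ≤ o Y × o Y ≤ k)
    ⊎ Kept X Y
    ⊎ Shifted X Y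

  InS→offset≤k : ∀ x → InS x → o x ≤ k
  InS→offset≤k x (i , i≤k , refl) = subst (_≤ k) (sym (c-init i i≤k)) i≤k

  ¬InS→k<offset : ∀ x → ¬ InS x → k < o x
  ¬InS→k<offset x ¬ins with o x ≤? k
  ... | yes h = ⊥-elim (¬ins (o x , h , star-at-offset x h))
  ... | no h = ≰⇒> h

  k<offset→¬InS : ∀ x → k < o x → ¬ InS x
  k<offset→¬InS x h ins = <⇒≱ h (InS→offset≤k x ins)

  InS⁺→offset : ∀ x → InS⁺ x → 1 ≤ o x × o x ≤ k
  InS⁺→offset x (i , 1≤i , i≤k , refl) = subst (λ w → 1 ≤ w × w ≤ k) (sym (c-init i i≤k)) (1≤i , i≤k)

  flatImg→FlatEdge : ∀ a b X Y → T a b → FlatImg a b X Y → FlatEdge X Y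
  flatImg→FlatEdge a b X Y tab (inj₁ (¬a , ¬b , refl , refl)) =
    inj₁ (tab , ¬InS→k<offset a ¬a , ¬InS→k<offset b ¬b)
  flatImg→FlatEdge a b X Y tab (inj₂ (inj₁ (ia , ib , refl , refl))) =
    let (1≤a , a≤k) = InS⁺→offset a ia ; (1≤b , b≤k) = InS⁺→offset b ib in
    inj₂ (inj₁ (tab , 1≤a , a≤k , 1≤b , b≤k))
  flatImg→FlatEdge a b X Y tab (inj₂ (inj₂ (zero , _ , refl , inj₁ (oc , refl , refl)))) =
    ⊥-elim (oc-empty (to (ocO (s k) b (s k)) (subst (OC (s k) b) (trans (sw-k+i 0 z≤n) (cong s (+-identityʳ k))) oc)))
  flatImg→FlatEdge a b X Y tab (inj₂ (inj₂ (suc i , i<k , refl , inj₁ (oc , refl , refl)))) =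
    inj₂ (inj₂ (inj₁ (suc i , s≤s z≤n , i<k , refl , proj₁ range , proj₂ range , tab)))
    where
    range : k < o b × o b ≤ c (k + suc i)
    range = to (oc-interval (k<c[k+i] (suc i) (s≤s z≤n) i<k))
          (subst (λ w → OCℕ w (o b) (c (k + suc i))) (c-init k ≤-refl)
            (to (ocO (s k) b (s (k + suc i))) (subst (OC (s k) b) (sw-k+i (suc i) i<k) oc)))
  flatImg→FlatEdge a b X Y tab (inj₂ (inj₂ (i , i≤k , refl , inj₂ (co , refl , refl)))) with m≤n⇒m<n∨m≡n i≤k
  ... | inj₂ refl = ⊥-elim (co-empty (to (coO (s 0) b (s 0)) (subst (λ w → CO w b (s 0)) sw-k+k+1 co)))
  ... | inj₁ i<k = inj₂ (inj₂ (inj₂ (i , i<k , cong s (+-comm i 1) , proj₂ range , tab)))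
    where
    range : 0 < c (k + suc i) × c (k + suc i) ≤ o b
    range = to co-tail₀ (subst (COℕ (c (k + suc i)) (o b)) (c-init 0 z≤n)
          (to (coO (s (k + suc i)) b (s 0)) (subst (λ w → CO w b (s 0)) (sw-k+i+1 i i<k) co)))

  flat→FlatEdge : ∀ X Y → FlatOut X Y → FlatEdge X Y ⊎ FlatEdge Y X
  flat→FlatEdge X Y (a , b , tab , inj₁ im) = inj₁ (flatImg→FlatEdge a b X Y tab im)
  flat→FlatEdge X Y (a , b , tab , inj₂ im) = inj₂ (flatImg→FlatEdge a b Y X tab im)

  flat-outer : ∀ X Y → T X Y → k < o X → k < o Y → FlatOut X Y
  flat-outer X Y txy hx hy = X , Y , txy , inj₁ (inj₁ (k<offset→¬InS X hx , k<offset→¬InS Y hy , refl , refl))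

  flat-inner : ∀ i j → 1 ≤ i → i ≤ k → 1 ≤ j → j ≤ k → T (s i) (s j) → FlatOut (s i) (s j)
  flat-inner i j 1≤i i≤k 1≤j j≤k tss =
    s i , s j , tss , inj₁ (inj₂ (inj₁ ((i , 1≤i , i≤k , refl) , (j , 1≤j , j≤k , refl) , refl , refl)))

  flat-keep : ∀ i Y → 1 ≤ i → i ≤ k → k < o Y → o Y ≤ c (k + i) → T (s i) Y → FlatOut (s i) Y
  flat-keep i Y 1≤i i≤k k<Y Y≤ tsy = s i , Y , tsy , inj₁ (inj₂ (inj₂ (i , i≤k , refl , inj₁ (oc , refl , refl))))
    where
    oc : OC (s k) Y (sw (k + i))
    oc = subst (OC (s k) Y) (sym (sw-k+i i i≤k))
          (from (ocO (s k) Y (s (k + i)))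
            (subst (λ w → OCℕ w (o Y) (c (k + i))) (sym (c-init k ≤-refl))
              (from (oc-interval (k<c[k+i] i 1≤i i≤k)) (k<Y , Y≤))))

  flat-shift : ∀ i Y → i < k → c (k + suc i) ≤ o Y → T (s i) Y → FlatOut (s (suc i)) Y
  flat-shift i Y i<k ≤Y tsy =
    s i , Y , tsy , inj₁ (inj₂ (inj₂ (i , <⇒≤ i<k , refl , inj₂ (co , cong s (+-comm 1 i) , refl))))
    where
    co : CO (sw (k + i + 1)) Y (s 0)
    co = subst (λ w → CO w Y (s 0)) (sym (sw-k+i+1 i i<k))
          (from (coO (s (k + suc i)) Y (s 0))
            (subst (COℕ (c (k + suc i)) (o Y)) (sym (c-init 0 z≤n))
              (from co-tail₀ (≤-<-trans z≤n (k<c[k+i] (suc i) (s≤s z≤n) i<k) , ≤Y))))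

  offset-of-star : ∀ {X i} → X ≡ s i → i ≤ k → o X ≡ i
  offset-of-star refl i≤k = c-init _ i≤k

  FlatEdge-outer : ∀ X Y → FlatEdge X Y → k < o X → k < o Y → T X Y
  FlatEdge-outer X Y (inj₁ (txy , _ , _)) _ _ = txy
  FlatEdge-outer X Y (inj₂ (inj₁ (_ , _ , X≤k , _))) k<X _ = ⊥-elim (<⇒≱ k<X X≤k)
  FlatEdge-outer X Y (inj₂ (inj₂ (inj₁ (i , _ , i≤k , e , _)))) k<X _ =
    ⊥-elim (<⇒≱ k<X (subst (_≤ k) (sym (offset-of-star e i≤k)) i≤k))
  FlatEdge-outer X Y (inj₂ (inj₂ (inj₂ (i , i<k , e , _)))) k<X _ =
    ⊥-elim (<⇒≱ k<X (subst (_≤ k) (sym (offset-of-star e i<k)) i<k))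

  FlatEdge-inner : ∀ X Y → FlatEdge X Y → o X ≤ k → o Y ≤ k → T X Y
  FlatEdge-inner X Y (inj₁ (_ , k<X , _)) X≤k _ = ⊥-elim (<⇒≱ k<X X≤k)
  FlatEdge-inner X Y (inj₂ (inj₁ (txy , _))) _ _ = txy
  FlatEdge-inner X Y (inj₂ (inj₂ (inj₁ (_ , _ , _ , _ , k<Y , _)))) _ Y≤k = ⊥-elim (<⇒≱ k<Y Y≤k)
  FlatEdge-inner X Y (inj₂ (inj₂ (inj₂ (i , i<k , _ , ≤Y , _)))) _ Y≤k =
    ⊥-elim (<⇒≱ (<-≤-trans (k<c[k+i] (suc i) (s≤s z≤n) i<k) ≤Y) Y≤k)

  FlatEdge-not-outward : ∀ X Y → FlatEdge X Y → k < o X → o Y ≤ k → ⊥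
  FlatEdge-not-outward X Y (inj₁ (_ , _ , k<Y)) _ Y≤k = <⇒≱ k<Y Y≤k
  FlatEdge-not-outward X Y (inj₂ (inj₁ (_ , _ , X≤k , _))) k<X _ = <⇒≱ k<X X≤k
  FlatEdge-not-outward X Y (inj₂ (inj₂ (inj₁ (i , _ , i≤k , e , _)))) k<X _ =
    <⇒≱ k<X (subst (_≤ k) (sym (offset-of-star e i≤k)) i≤k)
  FlatEdge-not-outward X Y (inj₂ (inj₂ (inj₂ (i , i<k , e , _)))) k<X _ =
    <⇒≱ k<X (subst (_≤ k) (sym (offset-of-star e i<k)) i<k)

  FlatEdge-outward : ∀ X Y → FlatEdge X Y → o X ≤ k → k < o Y → Kept X Y ⊎ Shifted X Y
  FlatEdge-outward X Y (inj₁ (_ , k<X , _)) X≤k _ = ⊥-elim (<⇒≱ k<X X≤k)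
  FlatEdge-outward X Y (inj₂ (inj₁ (_ , _ , _ , _ , Y≤k))) _ k<Y = ⊥-elim (<⇒≱ k<Y Y≤k)
  FlatEdge-outward X Y (inj₂ (inj₂ (inj₁ kept))) _ _ = inj₁ kept
  FlatEdge-outward X Y (inj₂ (inj₂ (inj₂ shifted))) _ _ = inj₂ shifted

cross-distinct : ∀ {N} {a b c d : Fin N} → Cross (a , b) (c , d) → (a ≢ c × a ≢ d) × (b ≢ c × b ≢ d)
cross-distinct (inj₁ (h₁ , h₂)) =
  let (p₁ , q₁ , _) = cyc-distinct h₁ ; (p₂ , q₂ , _) = cyc-distinct h₂ in
  ((p₁ ∘ cong toℕ) , (q₂ ∘ cong toℕ ∘ sym)) , ((q₁ ∘ cong toℕ ∘ sym) , (p₂ ∘ cong toℕ))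
cross-distinct (inj₂ (h₁ , h₂)) =
  let (p₁ , q₁ , _) = cyc-distinct h₁ ; (p₂ , q₂ , _) = cyc-distinct h₂ in
  ((q₁ ∘ cong toℕ ∘ sym) , (p₂ ∘ cong toℕ)) , ((p₁ ∘ cong toℕ) , (q₂ ∘ cong toℕ ∘ sym))

module Crossings {n : ℕ} (z : Fin (suc n)) where
  open Offset z

  increasing-crossing : (T : EdgeSet (suc n)) (m : ℕ) (L H : ℕ → Fin (suc n)) →
    (∀ q → q < m → T (L q) (H q)) →
    (∀ q q' → q < q' → q' < m → o (L q) < o (L q')) →
    (∀ q q' → q < q' → q' < m → o (H q) < o (H q')) →
    (∀ q q' → q < m → q' < m → o (L q) < o (H q')) →
    Crossing T m
  increasing-crossing T m L H edge L-inc H-inc L<H = e , (λ q → edge (toℕ q) (toℕ<n q)) , crossing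
    where
    e : Fin m → Fin (suc n) × Fin (suc n)
    e q = L (toℕ q) , H (toℕ q)
    crossing : ∀ q q' → q ≢ q' → Cross (e q) (e q')
    crossing q q' q≢q' with <-cmp (toℕ q) (toℕ q')
    ... | tri< lt _ _ = cross-alternating (L (toℕ q)) (H (toℕ q)) (L (toℕ q')) (H (toℕ q'))
            (L-inc _ _ lt (toℕ<n q')) (L<H _ _ (toℕ<n q') (toℕ<n q)) (H-inc _ _ lt (toℕ<n q'))
    ... | tri≈ _ eq _ = ⊥-elim (q≢q' (toℕ-injective eq))
    ... | tri> _ _ gt = cross-alternating′ (L (toℕ q)) (H (toℕ q)) (L (toℕ q')) (H (toℕ q'))
            (L-inc _ _ gt (toℕ<n q)) (L<H _ _ (toℕ<n q) (toℕ<n q')) (H-inc _ _ gt (toℕ<n q))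

  -- Only b − 1 vertices lie strictly between offsets 0 and b, so any b of
  -- them contain a repetition.
  crowded-arc : ∀ {m} b (W : Fin m → Fin (suc n)) → 1 ≤ b → b ≤ m →
                (∀ j → 0 < o (W j) × o (W j) < b) → ∃₂ λ j j' → j ≢ j' × W j ≡ W j'
  crowded-arc {m} b W 1≤b b≤m inside with pigeonhole (<-≤-trans (∸-monoʳ-< z<s 1≤b) b≤m) slot
    where
    slot : Fin m → Fin (b ∸ 1)
    slot j = fromℕ< (∸-monoˡ-< (proj₂ (inside j)) (proj₁ (inside j)))
  ... | j , j' , j<j' , same-slot = j , j' , (λ { refl → <-irrefl refl j<j' }) , o-inj same-offset
    where
    same-offset : o (W j) ≡ o (W j')
    same-offset = ∸-cancelʳ-≡ (proj₁ (inside j)) (proj₁ (inside j'))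
      (trans (sym (toℕ-fromℕ< _)) (trans (cong toℕ same-slot) (toℕ-fromℕ< _)))

-- Every k-triangulation contains the edges of length at most k: if
-- 1 ≤ o B ≤ k (offset measured from A), adding [A, B] creates no
-- (k+1)-crossing, because the other k edges of such a crossing would need k
-- distinct endpoints strictly inside the arc (A, B), which has only o B − 1
-- vertices.  Maximality then puts [A, B] in T.
short-edge : ∀ {n} k (T : EdgeSet (suc n)) → KTriangulation k T → ∀ A B →
             1 ≤ Offset.o A B → Offset.o A B ≤ k → T A B
short-edge {n} k T ((T-sym , T-loopless) , T-free , T-maximal) A B 1≤B B≤k =
  T-maximal T⁺ (T⁺-sym , T⁺-loopless) T⁺-free (λ _ _ → inj₁) A B (inj₂ (inj₁ (refl , refl)))
  where
  open Offset A
  open Crossings A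

  IsAB : Fin (suc n) → Fin (suc n) → Set
  IsAB u v = (u ≡ A × v ≡ B) ⊎ (u ≡ B × v ≡ A)

  T⁺ : EdgeSet (suc n)
  T⁺ u v = T u v ⊎ IsAB u v

  A≢B : A ≢ B
  A≢B A≡B = <-irrefl (trans (sym o-self) (cong o A≡B)) 1≤B

  T⁺-sym : ∀ u v → T⁺ u v → T⁺ v u
  T⁺-sym u v (inj₁ tuv) = inj₁ (T-sym u v tuv)
  T⁺-sym u v (inj₂ (inj₁ (p , q))) = inj₂ (inj₂ (q , p))
  T⁺-sym u v (inj₂ (inj₂ (p , q))) = inj₂ (inj₁ (q , p))

  T⁺-loopless : ∀ u → ¬ T⁺ u u
  T⁺-loopless u (inj₁ tuu) = T-loopless u tuu
  T⁺-loopless u (inj₂ (inj₁ (p , q))) = A≢B (trans (sym p) q)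
  T⁺-loopless u (inj₂ (inj₂ (p , q))) = A≢B (trans (sym q) p)

  isAB? : ∀ (e : Fin (suc n) × Fin (suc n)) → Dec (IsAB (proj₁ e) (proj₂ e))
  isAB? (u , v) = ((u ≟F A) ×-dec (v ≟F B)) ⊎-dec ((u ≟F B) ×-dec (v ≟F A))

  Inside : Fin (suc n) → Set
  Inside w = 0 < o w × o w < o B

  inside : ∀ w → Cyc A w B → Inside w
  inside w cy = to cyc-zero (subst (λ z → Cycℕ z (o w) (o B)) o-self (to (cycO A w B) cy))

  endpoint-inside : ∀ a b c d → IsAB a b → Cross (a , b) (c , d) →
                    Σ (Fin (suc n)) λ w → (w ≡ c ⊎ w ≡ d) × Inside w
  endpoint-inside a b c d (inj₁ (refl , refl)) (inj₁ (h , _)) = c , inj₁ refl , inside c h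
  endpoint-inside a b c d (inj₁ (refl , refl)) (inj₂ (_ , h)) = d , inj₂ refl , inside d h
  endpoint-inside a b c d (inj₂ (refl , refl)) (inj₁ (_ , h)) = d , inj₂ refl , inside d h
  endpoint-inside a b c d (inj₂ (refl , refl)) (inj₂ (h , _)) = c , inj₁ refl , inside c h

  T⁺-free : ¬ Crossing T⁺ (suc k)
  T⁺-free (e , in-T⁺ , crossing) with any? (λ j → isAB? (e j))
  ... | no no-AB = T-free (e , in-T , crossing)
    where
    in-T : ∀ j → T (proj₁ (e j)) (proj₂ (e j))
    in-T j with in-T⁺ j
    ... | inj₁ tj = tj
    ... | inj₂ ab = ⊥-elim (no-AB (j , ab))
  ... | yes (j₀ , ab) = crowded
    where
    edge : Fin k → Fin (suc n) × Fin (suc n)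
    edge m = e (punchIn j₀ m)
    witness : ∀ m → Σ (Fin (suc n)) λ w → (w ≡ proj₁ (edge m) ⊎ w ≡ proj₂ (edge m)) × Inside w
    witness m = endpoint-inside _ _ _ _ ab (crossing j₀ (punchIn j₀ m) (λ eq → punchInᵢ≢i j₀ m (sym eq)))
    W : Fin k → Fin (suc n)
    W m = proj₁ (witness m)
    -- mutually crossing edges share no endpoint, so the W m are distinct
    W-injective : ∀ m m' → m ≢ m' → W m ≢ W m'
    W-injective m m' m≢m' eq
      with cross-distinct (crossing (punchIn j₀ m) (punchIn j₀ m') (m≢m' ∘ punchIn-injective j₀ m m'))
         | proj₁ (proj₂ (witness m)) | proj₁ (proj₂ (witness m'))
    ... | (p₁ , p₂) , _ | inj₁ x | inj₁ y = p₁ (trans (sym x) (trans eq y))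
    ... | (p₁ , p₂) , _ | inj₁ x | inj₂ y = p₂ (trans (sym x) (trans eq y))
    ... | _ , (p₃ , p₄) | inj₂ x | inj₁ y = p₃ (trans (sym x) (trans eq y))
    ... | _ , (p₃ , p₄) | inj₂ x | inj₂ y = p₄ (trans (sym x) (trans eq y))
    crowded : ⊥
    crowded with crowded-arc (o B) W 1≤B B≤k (λ m → proj₂ (proj₂ (witness m)))
    ... | m , m' , m≢m' , Wm≡Wm' = W-injective m m' m≢m' Wm≡Wm'

-- T is a k-triangulation of the (n+1)-gon, s its k-star through
-- the k-boundary edge [s 0, s k], and t the vertices of the glued crossing
-- in the labelling of the n-gon (punchIn (s 0) (t j) = s j).
module FlattenThenInflate {n k : ℕ} (1≤k : 1 ≤ k) (T : EdgeSet (suc n)) (KT : KTriangulation k T)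
  (s : ℕ → Fin (suc n)) (star : IsKStarOf k T s) (sk≡s0⊕k : s k ≡ s 0 ⊕ k)
  (t : ℕ → Fin n) (t-lift : ∀ j → 1 ≤ j → j ≤ 2 * k → punchIn (s 0) (t j) ≡ s j) where

  open Offset (s 0)
  open StarOffsets k 1≤k s (s 0) refl (proj₁ star)

  T-sym : ∀ u v → T u v → T v u
  T-sym = proj₁ (proj₁ KT)

  ck≡k : c k ≡ k
  ck≡k = trans (cong o sk≡s0⊕k) (o-⊕ k (≤-<-trans k≤ck (o<N (s k))))

  c-init : ∀ i → i ≤ k → c i ≡ i
  c-init = consecutive ck≡k

  open FlattenDescription k T s (s 0) c-init c-inc hiding (c)
  open FlattenCases k T s using (FlatOut)
  open PunchIn (s 0)
  open LiftedArcs (s 0)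

  F : EdgeSet n
  F = Flatten k T s

  open InflateCases k F t (s 0)

  ns≡s : ∀ j → j ≤ 2 * k → ns j ≡ s j
  ns≡s zero _ = refl
  ns≡s (suc j) h = t-lift (suc j) (s≤s z≤n) h

  ι[t]≡s : ∀ i → 1 ≤ i → i ≤ k → ι (t i) ≡ s i
  ι[t]≡s i 1≤i i≤k = t-lift i 1≤i (≤-trans i≤k (k≤2k k))

  o[ι[t]] : ∀ i → 1 ≤ i → i ≤ k → o (ι (t i)) ≡ i
  o[ι[t]] i 1≤i i≤k = trans (cong o (ι[t]≡s i 1≤i i≤k)) (c-init i i≤k)

  InA→offset≤k : ∀ u → InA u → o (ι u) ≤ k
  InA→offset≤k u (i , 1≤i , i≤k , refl) = subst (_≤ k) (sym (o[ι[t]] i 1≤i i≤k)) i≤k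

  offset≤k→InA : ∀ u → o (ι u) ≤ k → InA u
  offset≤k→InA u h = o (ι u) , 1≤o[ι] u , h ,
    ι-inj (trans (star-at-offset (ι u) h) (sym (ι[t]≡s (o (ι u)) (1≤o[ι] u) h)))

  short : ∀ i → 1 ≤ i → i ≤ k → T (s 0) (s i)
  short i 1≤i i≤k = short-edge k T KT (s 0) (s i)
    (subst (1 ≤_) (sym (c-init i i≤k)) 1≤i) (subst (_≤ k) (sym (c-init i i≤k)) i≤k)

  -- T has no edge [s i, y] with y strictly inside the angle between the
  -- star edges [s i, s (k+i)] and [s i, s (k+i+1)] (for i = k: beyond s 2k):
  -- it would complete the k+1 edges [s q, H q] below to a (k+1)-crossing.
  module Angle (i : ℕ) (y : Fin (suc n)) (i≤k : i ≤ k) (tsy : T (s i) y)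
    (after : c (k + i) < o y) (before : i ≡ k ⊎ o y < c (k + suc i)) where

    H : ℕ → Fin (suc n)
    H q with <-cmp q i
    ... | tri< _ _ _ = s (k + suc q)
    ... | tri≈ _ _ _ = y
    ... | tri> _ _ _ = s (k + q)

    H-cases : ∀ q → (q < i × H q ≡ s (k + suc q)) ⊎ (q ≡ i × H q ≡ y) ⊎ (i < q × H q ≡ s (k + q))
    H-cases q with <-cmp q i
    ... | tri< a _ _ = inj₁ (a , refl)
    ... | tri≈ _ b _ = inj₂ (inj₁ (b , refl))
    ... | tri> _ _ c' = inj₂ (inj₂ (c' , refl))

    k≤c[k+i] : k ≤ c (k + i)
    k≤c[k+i] = subst (_≤ c (k + i)) ck≡k (c-mono k (k + i) (m≤m+n k i) (k+i≤2k k i i≤k))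

    k<H : ∀ q → q ≤ k → k < o (H q)
    k<H q q≤k with H-cases q
    ... | inj₁ (q<i , e) rewrite e = k<c[k+i] (suc q) (s≤s z≤n) (≤-trans q<i i≤k)
    ... | inj₂ (inj₁ (_ , e)) rewrite e = ≤-<-trans k≤c[k+i] after
    ... | inj₂ (inj₂ (i<q , e)) rewrite e = k<c[k+i] q (≤-trans (s≤s z≤n) i<q) q≤k

    edges : ∀ q → q < suc k → T (s q) (H q)
    edges q q≤k with H-cases q
    ... | inj₁ (q<i , e) rewrite e = star-edge′ k T s star T-sym q (<-≤-trans q<i i≤k)
    ... | inj₂ (inj₁ (q≡i , e)) rewrite e | q≡i = tsy
    ... | inj₂ (inj₂ (_ , e)) rewrite e = star-edge k T s star q (≤-pred q≤k)

    s-inc : ∀ q q' → q < q' → q' < suc k → o (s q) < o (s q')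
    s-inc q q' q<q' q'≤k rewrite c-init q (≤-trans (<⇒≤ q<q') (≤-pred q'≤k)) | c-init q' (≤-pred q'≤k) = q<q'

    s<H : ∀ q q' → q < suc k → q' < suc k → o (s q) < o (H q')
    s<H q q' q≤k q'≤k rewrite c-init q (≤-pred q≤k) = ≤-<-trans (≤-pred q≤k) (k<H q' (≤-pred q'≤k))

    H-inc : ∀ q q' → q < q' → q' < suc k → o (H q) < o (H q')
    H-inc q q' q<q' q'≤k with H-cases q | H-cases q'
    ... | inj₁ (a , e) | inj₁ (a' , e') rewrite e | e' =
      c-inc (k + suc q) (k + suc q') (+-monoʳ-< k (s≤s q<q')) (k+i≤2k k (suc q') (<-≤-trans a' i≤k))
    ... | inj₁ (a , e) | inj₂ (inj₁ (_ , e')) rewrite e | e' =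
      ≤-<-trans (c-mono (k + suc q) (k + i) (+-monoʳ-≤ k a) (k+i≤2k k i i≤k)) after
    ... | inj₁ (a , e) | inj₂ (inj₂ (a' , e')) rewrite e | e' =
      c-inc (k + suc q) (k + q') (+-monoʳ-< k (≤-<-trans a a')) (k+i≤2k k q' (≤-pred q'≤k))
    ... | inj₂ (inj₁ (b , _)) | inj₁ (a' , _) = ⊥-elim (<-asym (subst (_< q') b q<q') a')
    ... | inj₂ (inj₁ (b , _)) | inj₂ (inj₁ (b' , _)) = ⊥-elim (<-irrefl (trans b (sym b')) q<q')
    ... | inj₂ (inj₁ (_ , e)) | inj₂ (inj₂ (a' , e')) rewrite e | e' = below-next before
      where
      below-next : i ≡ k ⊎ o y < c (k + suc i) → o y < c (k + q')
      below-next (inj₁ refl) = ⊥-elim (<⇒≱ a' (≤-pred q'≤k))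
      below-next (inj₂ lt) = <-≤-trans lt (c-mono (k + suc i) (k + q') (+-monoʳ-≤ k a') (k+i≤2k k q' (≤-pred q'≤k)))
    H-inc q q' q<q' q'≤k | inj₂ (inj₂ (a , _)) | inj₁ (a' , _) = ⊥-elim (<-asym (<-trans a q<q') a')
    H-inc q q' q<q' q'≤k | inj₂ (inj₂ (a , _)) | inj₂ (inj₁ (b' , _)) = ⊥-elim (<-irrefl (sym b') (<-trans a q<q'))
    H-inc q q' q<q' q'≤k | inj₂ (inj₂ (a , e)) | inj₂ (inj₂ (a' , e')) rewrite e | e' =
      c-inc (k + q) (k + q') (+-monoʳ-< k q<q') (k+i≤2k k q' (≤-pred q'≤k))

    impossible : ⊥
    impossible = proj₁ (proj₂ KT) (Crossings.increasing-crossing (s 0) T (suc k) s H edges s-inc H-inc s<H)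

  no-edge-in-angle : ∀ i y → i ≤ k → T (s i) y → c (k + i) < o y → (i ≡ k ⊎ o y < c (k + suc i)) → ⊥
  no-edge-in-angle i y i≤k tsy after before = Angle.impossible i y i≤k tsy after before

  o[ι[t[k+i]]] : ∀ i → 1 ≤ i → i ≤ k → o (ι (t (k + i))) ≡ c (k + i)
  o[ι[t[k+i]]] i 1≤i i≤k = cong o (t-lift (k + i) (≤-trans 1≤i (m≤n+m i k)) (k+i≤2k k i i≤k))

  keep-arc : ∀ i b → 1 ≤ i → i ≤ k → OC (t k) b (t (k + i)) ⇔ (k < o (ι b) × o (ι b) ≤ c (k + i))
  keep-arc i b 1≤i i≤k =
    subst₂ (λ u w → OC (t k) b (t (k + i)) ⇔ (u < o (ι b) × o (ι b) ≤ w))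
      (o[ι[t]] k 1≤k ≤-refl) (o[ι[t[k+i]]] i 1≤i i≤k)
      (oc-lifted (t k) b (t (k + i))
        (subst₂ _<_ (sym (o[ι[t]] k 1≤k ≤-refl)) (sym (o[ι[t[k+i]]] i 1≤i i≤k)) (k<c[k+i] i 1≤i i≤k)))

  shift-arc : ∀ i b → 1 ≤ i → i ≤ k → CO (t (k + i)) b (t 1) ⇔ c (k + i) ≤ o (ι b)
  shift-arc i b 1≤i i≤k =
    subst (λ w → CO (t (k + i)) b (t 1) ⇔ w ≤ o (ι b)) (o[ι[t[k+i]]] i 1≤i i≤k)
      (co-lifted (t (k + i)) b (t 1) (o[ι[t]] 1 ≤-refl 1≤k)
        (subst (1 <_) (sym (o[ι[t[k+i]]] i 1≤i i≤k)) (≤-<-trans 1≤k (k<c[k+i] i 1≤i i≤k))))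

  inflate-keep : ∀ i b → 1 ≤ i → i ≤ k → k < o (ι b) → o (ι b) ≤ c (k + i) → T (s i) (ι b) → InflC (s i) (ι b)
  inflate-keep i b 1≤i i≤k k<b b≤ tsb =
    inj₁ (t i , b , in-F , inj₁ (inj₂ (inj₂ (i , 1≤i , i≤k , refl ,
      inj₁ (from (keep-arc i b 1≤i i≤k) (k<b , b≤) , sym (ι[t]≡s i 1≤i i≤k) , refl)))))
    where
    in-F : F (t i) b
    in-F = subst (λ w → FlatOut w (ι b)) (sym (ι[t]≡s i 1≤i i≤k)) (flat-keep i (ι b) 1≤i i≤k k<b b≤ tsb)

  inflate-shift : ∀ i b → i < k → c (k + suc i) ≤ o (ι b) → T (s i) (ι b) → InflC (s i) (ι b)
  inflate-shift i b i<k ≤b tsb =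
    inj₁ (t (suc i) , b , in-F , inj₁ (inj₂ (inj₂ (suc i , s≤s z≤n , i<k , refl ,
      inj₂ (from (shift-arc (suc i) b (s≤s z≤n) i<k) ≤b , sym (ns≡s i (≤-trans (<⇒≤ i<k) (k≤2k k))) , refl)))))
    where
    in-F : F (t (suc i)) b
    in-F = subst (λ w → FlatOut w (ι b)) (sym (ι[t]≡s (suc i) (s≤s z≤n) i<k)) (flat-shift i (ι b) i<k ≤b tsb)

  inflate-outward : ∀ i b → i ≤ k → k < o (ι b) → T (s i) (ι b) → InflC (s i) (ι b)
  inflate-outward i b i≤k k<b tsb with o (ι b) ≤? c (k + i)
  inflate-outward zero b i≤k k<b tsb | yes b≤ =
    ⊥-elim (<⇒≱ k<b (subst (o (ι b) ≤_) (trans (cong c (+-identityʳ k)) ck≡k) b≤))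
  inflate-outward (suc i) b i≤k k<b tsb | yes b≤ = inflate-keep (suc i) b (s≤s z≤n) i≤k k<b b≤ tsb
  inflate-outward i b i≤k k<b tsb | no b≰ with i <? k
  ... | no i≮k = ⊥-elim (no-edge-in-angle i (ι b) i≤k tsb (≰⇒> b≰) (inj₁ (≤-antisym i≤k (≮⇒≥ i≮k))))
  ... | yes i<k with c (k + suc i) ≤? o (ι b)
  ...   | yes ≤b = inflate-shift i b i<k ≤b tsb
  ...   | no ≰b = ⊥-elim (no-edge-in-angle i (ι b) i≤k tsb (≰⇒> b≰) (inj₂ (≰⇒> ≰b)))

  inflate-inner : ∀ i j → i ≤ k → j ≤ k → T (s i) (s j) → InflC (s i) (s j)
  inflate-inner zero zero _ _ tss = ⊥-elim (proj₂ (proj₁ KT) (s 0) tss)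
  inflate-inner zero (suc j) _ j≤k _ = inj₂ (suc j , s≤s z≤n , j≤k , inj₁ (refl , sym (ns≡s (suc j) (≤-trans j≤k (k≤2k k)))))
  inflate-inner (suc i) zero i≤k _ _ = inj₂ (suc i , s≤s z≤n , i≤k , inj₂ (refl , sym (ns≡s (suc i) (≤-trans i≤k (k≤2k k)))))
  inflate-inner (suc i) (suc j) i≤k j≤k tss =
    inj₁ (t (suc i) , t (suc j) , in-F , inj₁ (inj₂ (inj₁ ((suc i , s≤s z≤n , i≤k , refl) , (suc j , s≤s z≤n , j≤k , refl) ,
      sym (ι[t]≡s (suc i) (s≤s z≤n) i≤k) , sym (ι[t]≡s (suc j) (s≤s z≤n) j≤k)))))
    where
    in-F : F (t (suc i)) (t (suc j))
    in-F = subst₂ FlatOut (sym (ι[t]≡s (suc i) (s≤s z≤n) i≤k)) (sym (ι[t]≡s (suc j) (s≤s z≤n) j≤k))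
      (flat-inner (suc i) (suc j) (s≤s z≤n) i≤k (s≤s z≤n) j≤k tss)

  outer≢s0 : ∀ y → k < o y → y ≢ s 0
  outer≢s0 y k<y = ≢base y (≤-<-trans z≤n k<y)

  inflate-from-inner : ∀ x y → o x ≤ k → k < o y → T x y → InflC x y
  inflate-from-inner x y x≤k k<y txy with ι-surj y (outer≢s0 y k<y)
  ... | b , refl = subst (λ w → InflC w (ι b)) (sym (star-at-offset x x≤k))
        (inflate-outward (o x) b x≤k k<y (subst (λ w → T w (ι b)) (star-at-offset x x≤k) txy))

  T→inflated : ∀ x y → T x y → InflC x y
  T→inflated x y txy with o x ≤? k | o y ≤? k
  ... | yes x≤k | yes y≤k = subst₂ InflC (sym (star-at-offset x x≤k)) (sym (star-at-offset y y≤k))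
          (inflate-inner (o x) (o y) x≤k y≤k (subst₂ T (star-at-offset x x≤k) (star-at-offset y y≤k) txy))
  ... | yes x≤k | no y≰k = inflate-from-inner x y x≤k (≰⇒> y≰k) txy
  ... | no x≰k | yes y≤k = inflC-sym y x (inflate-from-inner y x y≤k (≰⇒> x≰k) (T-sym x y txy))
  ... | no x≰k | no y≰k with ι-surj x (outer≢s0 x (≰⇒> x≰k)) | ι-surj y (outer≢s0 y (≰⇒> y≰k))
  ...   | a , refl | b , refl = inj₁ (a , b , flat-outer (ι a) (ι b) txy (≰⇒> x≰k) (≰⇒> y≰k) ,
          inj₁ (inj₁ (<⇒≱ (≰⇒> x≰k) ∘ InA→offset≤k a , <⇒≱ (≰⇒> y≰k) ∘ InA→offset≤k b , refl , refl)))

  -- A kept edge [t i, b] of the flattening is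
  -- either an edge [s i, b] of T or a glued star edge; a moved edge
  -- [s (i-1), b] is a shifted edge of T or the star edge [s (i-1), s (k+i)];
  -- the new edges [s 0, s i] are short edges of T.
  same-index : ∀ {i j} → ι (t i) ≡ s j → 1 ≤ i → i ≤ k → j ≤ k → i ≡ j
  same-index e 1≤i i≤k j≤k = trans (sym (o[ι[t]] _ 1≤i i≤k)) (offset-of-star e j≤k)

  inflated-image→T : ∀ a b x y → F a b → InfImg a b x y → T x y
  inflated-image→T a b x y fab (inj₁ (¬a , ¬b , refl , refl)) with flat→FlatEdge (ι a) (ι b) fab
  ... | inj₁ e = FlatEdge-outer _ _ e (≰⇒> (¬a ∘ offset≤k→InA a)) (≰⇒> (¬b ∘ offset≤k→InA b))
  ... | inj₂ e = T-sym _ _ (FlatEdge-outer _ _ e (≰⇒> (¬b ∘ offset≤k→InA b)) (≰⇒> (¬a ∘ offset≤k→InA a)))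
  inflated-image→T a b x y fab (inj₂ (inj₁ (ia , ib , refl , refl))) with flat→FlatEdge (ι a) (ι b) fab
  ... | inj₁ e = FlatEdge-inner _ _ e (InA→offset≤k a ia) (InA→offset≤k b ib)
  ... | inj₂ e = T-sym _ _ (FlatEdge-inner _ _ e (InA→offset≤k b ib) (InA→offset≤k a ia))
  inflated-image→T a b x y fab (inj₂ (inj₂ (i , 1≤i , i≤k , refl , inj₁ (oc , refl , refl))))
    with to (keep-arc i b 1≤i i≤k) oc | flat→FlatEdge (ι (t i)) (ι b) fab
  ... | (k<b , _) | inj₂ e = ⊥-elim (FlatEdge-not-outward _ _ e k<b (subst (_≤ k) (sym (o[ι[t]] i 1≤i i≤k)) i≤k))
  ... | (k<b , b≤) | inj₁ e with FlatEdge-outward _ _ e (subst (_≤ k) (sym (o[ι[t]] i 1≤i i≤k)) i≤k) k<b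
  ...   | inj₁ (_ , _ , _ , _ , _ , _ , tab) = tab
  ...   | inj₂ (i' , i'<k , e′ , ≤b , _) with same-index e′ 1≤i i≤k i'<k
  ...     | refl = subst₂ T (sym (ι[t]≡s (suc i') 1≤i i≤k)) (sym (o-inj (≤-antisym b≤ ≤b)))
                     (star-edge k T s star (suc i') i≤k)
  inflated-image→T a b x y fab (inj₂ (inj₂ (i , 1≤i , i≤k , refl , inj₂ (co , refl , refl))))
    with to (shift-arc i b 1≤i i≤k) co | flat→FlatEdge (ι (t i)) (ι b) fab
  ... | ≤b | inj₂ e = ⊥-elim (FlatEdge-not-outward _ _ e (<-≤-trans (k<c[k+i] i 1≤i i≤k) ≤b)
                        (subst (_≤ k) (sym (o[ι[t]] i 1≤i i≤k)) i≤k))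
  ... | ≤b | inj₁ e with FlatEdge-outward _ _ e (subst (_≤ k) (sym (o[ι[t]] i 1≤i i≤k)) i≤k) (<-≤-trans (k<c[k+i] i 1≤i i≤k) ≤b)
  ...   | inj₁ (i' , _ , i'≤k , e′ , _ , b≤ , _) with same-index e′ 1≤i i≤k i'≤k
  ...     | refl = previous-star-edge i 1≤i i≤k (o-inj (≤-antisym b≤ ≤b))
    where
    previous-star-edge : ∀ i → 1 ≤ i → i ≤ k → ι b ≡ s (k + i) → T (ns (i ∸ 1)) (ι b)
    previous-star-edge (suc j) _ j<k e = subst₂ T (sym (ns≡s j (≤-trans (<⇒≤ j<k) (k≤2k k)))) (sym e) (star-edge′ k T s star T-sym j j<k)
  inflated-image→T a b x y fab (inj₂ (inj₂ (i , 1≤i , i≤k , refl , inj₂ (co , refl , refl)))) | ≤b | inj₁ e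
    | inj₂ (i' , i'<k , e′ , _ , tsb) with same-index e′ 1≤i i≤k i'<k
  ... | refl = subst (λ w → T w (ι b)) (sym (ns≡s i' (≤-trans (<⇒≤ i'<k) (k≤2k k)))) tsb

  inflated→T : ∀ x y → InflC x y → T x y
  inflated→T x y (inj₁ (a , b , fab , inj₁ im)) = inflated-image→T a b x y fab im
  inflated→T x y (inj₁ (a , b , fab , inj₂ im)) = T-sym _ _ (inflated-image→T a b y x fab im)
  inflated→T x y (inj₂ (i , 1≤i , i≤k , inj₁ (refl , refl))) =
    subst (T (s 0)) (sym (ns≡s i (≤-trans i≤k (k≤2k k)))) (short i 1≤i i≤k)
  inflated→T x y (inj₂ (i , 1≤i , i≤k , inj₂ (refl , refl))) =
    T-sym _ _ (subst (T (s 0)) (sym (ns≡s i (≤-trans i≤k (k≤2k k)))) (short i 1≤i i≤k))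

  flatten-then-inflate : ∀ u v → Inflate k F t (s 0) u v ⇔ T u v
  flatten-then-inflate u v = mk⇔ (inflated→T u v ∘ inflate→cases u v) (cases→inflate u v ∘ T→inflated u v)

-- T is a k-triangulation of the n-gon, t 1 … t 2k a k-crossing
-- of T with t 1 … t k consecutive, p the new vertex just before t 1, and s a
-- k-star of the inflation U through the edge [p, t k].
module InflateThenFlatten {n k : ℕ} (1≤k : 1 ≤ k) (T : EdgeSet n) (KT : KTriangulation k T)
  (t : ℕ → Fin n) (crossing : IsConsecKCrossingOf k T t)
  (p : Fin (suc n)) (p⊕1≡t1 : p ⊕ 1 ≡ punchIn p (t 1))
  (s : ℕ → Fin (suc n)) (star : IsKStarOf k (Inflate k T t p) s)
  (s0≡p : s 0 ≡ p) (sk≡tk : s k ≡ punchIn p (t k)) where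

  U : EdgeSet (suc n)
  U = Inflate k T t p

  open Offset p
  open PunchIn p
  open LiftedArcs p
  open InflateCases k T t p

  T-sym : ∀ u v → T u v → T v u
  T-sym = proj₁ (proj₁ KT)

  t-ordered : ∀ i j l → 1 ≤ i → i < j → j < l → l ≤ 2 * k → Cyc (t i) (t j) (t l)
  t-ordered = proj₁ crossing

  t-edge : ∀ i → 1 ≤ i → i ≤ k → T (t i) (t (k + i))
  t-edge = proj₁ (proj₂ crossing)

  t-consecutive : ∀ i → 1 ≤ i → i ≤ k → t i ≡ t 1 ⊕ (i ∸ 1)
  t-consecutive = proj₂ (proj₂ (proj₂ crossing))

  -- Offsets of the crossing vertices from p: they increase from d 1 = 1,
  -- and d i = i for i ≤ k because t 1 … t k are consecutive.
  d : ℕ → ℕ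
  d j = o (ι (t j))

  d1≡1 : d 1 ≡ 1
  d1≡1 = trans (cong o (sym p⊕1≡t1)) (o-⊕ 1 (s≤s (≤-trans (s≤s z≤n) (toℕ<n (t 1)))))

  d-between : ∀ i j → 1 < i → i < j → j ≤ 2 * k → 1 < d i × d i < d j
  d-between i j 1<i i<j j≤2k =
    from-one (subst (λ w → Cycℕ w (d i) (d j)) d1≡1
      (to (cycO (ι (t 1)) (ι (t i)) (ι (t j))) (to (cycI (t 1) (t i) (t j)) (t-ordered 1 i j ≤-refl 1<i i<j j≤2k))))
    where
    from-one : Cycℕ 1 (d i) (d j) → 1 < d i × d i < d j
    from-one (inj₁ r) = r
    from-one (inj₂ (inj₁ (_ , dj<1))) = ⊥-elim (<-irrefl refl (≤-trans dj<1 (1≤o[ι] (t j))))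
    from-one (inj₂ (inj₂ (dj<1 , _))) = ⊥-elim (<-irrefl refl (≤-trans dj<1 (1≤o[ι] (t j))))

  -- t 2k ≠ t 1; for k = 1 this is the edge [t 1, t 2] of T.
  1<d : ∀ j → 1 < j → j ≤ 2 * k → 1 < d j
  1<d j 1<j j≤2k with m≤n⇒m<n∨m≡n j≤2k
  ... | inj₁ j<2k = proj₁ (d-between j (2 * k) 1<j j<2k ≤-refl)
  ... | inj₂ refl with 2 <? 2 * k
  ...   | yes 2<2k = let (p₁ , p₂) = d-between 2 (2 * k) ≤-refl 2<2k ≤-refl in <-trans p₁ p₂
  ...   | no 2≮2k = ≤∧≢⇒< (1≤o[ι] (t (2 * k))) d[2k]≢1
    where
    k≡1 : k ≡ 1
    k≡1 = ≤-antisym (*-cancelˡ-≤ 2 (≮⇒≥ 2≮2k)) 1≤k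
    k+1≡2k : k + 1 ≡ 2 * k
    k+1≡2k = subst (λ w → w + 1 ≡ 2 * w) (sym k≡1) refl
    d[2k]≢1 : 1 ≢ d (2 * k)
    d[2k]≢1 e = proj₂ (proj₁ KT) (t 1) (subst (T (t 1)) (sym t1≡t[k+1]) (t-edge 1 ≤-refl 1≤k))
      where
      t1≡t[k+1] : t 1 ≡ t (k + 1)
      t1≡t[k+1] = trans (ι-inj (o-inj (trans d1≡1 e))) (cong t (sym k+1≡2k))

  d-inc : ∀ i j → 1 ≤ i → i < j → j ≤ 2 * k → d i < d j
  d-inc 1 j _ 1<j j≤2k = subst (_< d j) (sym d1≡1) (1<d j 1<j j≤2k)
  d-inc (suc (suc i)) j _ i<j j≤2k = proj₂ (d-between (suc (suc i)) j (s≤s (s≤s z≤n)) i<j j≤2k)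

  t-step : ∀ i → 1 ≤ i → i < k → t (suc i) ≡ t i ⊕ 1
  t-step (suc i) _ i<k = trans (t-consecutive (suc (suc i)) (s≤s z≤n) i<k)
    (trans (sym (⊕-suc (t 1) i)) (cong (_⊕ 1) (sym (t-consecutive (suc i) (s≤s z≤n) (<⇒≤ i<k)))))

  -- Consecutive vertices stay at consecutive offsets after lifting: any
  -- vertex at an offset strictly between would lie between t i and t i ⊕ 1.
  d-step : ∀ i → 1 ≤ i → i < k → d (suc i) ≤ suc (d i)
  d-step i 1≤i i<k with d (suc i) ≤? suc (d i)
  ... | yes h = h
  ... | no h = ⊥-elim (nothing-between-neighbours (t i) x (subst (Cyc (t i) x) (t-step i 1≤i i<k) between))
    where
    gap : suc (d i) < d (suc i)
    gap = ≰⇒> h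
    w : Fin (suc n)
    w = p ⊕ suc (d i)
    o-w : o w ≡ suc (d i)
    o-w = o-⊕ (suc (d i)) (<-trans gap (o<N (ι (t (suc i)))))
    w≢p : w ≢ p
    w≢p = ≢base w (subst (0 <_) (sym o-w) z<s)
    x : Fin n
    x = proj₁ (ι-surj w w≢p)
    o-x : o (ι x) ≡ suc (d i)
    o-x = trans (cong o (proj₂ (ι-surj w w≢p))) o-w
    between : Cyc (t i) x (t (suc i))
    between = from (cycI (t i) x (t (suc i))) (from (cycO (ι (t i)) (ι x) (ι (t (suc i))))
      (inj₁ (subst (d i <_) (sym o-x) (n<1+n (d i)) , subst (_< d (suc i)) (sym o-x) gap)))

  d-init : ∀ i → 1 ≤ i → i ≤ k → d i ≡ i
  d-init 1 _ _ = d1≡1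
  d-init (suc (suc i)) _ i<k = next (d-init (suc i) (s≤s z≤n) (<⇒≤ i<k))
    where
    next : d (suc i) ≡ suc i → d (suc (suc i)) ≡ suc (suc i)
    next previous = ≤-antisym
      (subst (λ w → d (suc (suc i)) ≤ suc w) previous (d-step (suc i) (s≤s z≤n) i<k))
      (subst (λ w → suc w ≤ d (suc (suc i))) previous
        (d-inc (suc i) (suc (suc i)) (s≤s z≤n) ≤-refl (≤-trans i<k (k≤2k k))))

  dk≡k : d k ≡ k
  dk≡k = d-init k 1≤k ≤-refl

  k<d[k+j] : ∀ j → 1 ≤ j → j ≤ k → k < d (k + j)
  k<d[k+j] j 1≤j j≤k = subst (_< d (k + j)) dk≡k
    (d-inc k (k + j) 1≤k (subst (_≤ k + j) (+-comm k 1) (+-monoʳ-≤ k 1≤j)) (k+i≤2k k j j≤k))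

  InA→offset≤k : ∀ u → InA u → o (ι u) ≤ k
  InA→offset≤k u (i , 1≤i , i≤k , refl) = subst (_≤ k) (sym (d-init i 1≤i i≤k)) i≤k

  offset≤k→InA : ∀ u → o (ι u) ≤ k → InA u
  offset≤k→InA u h = o (ι u) , 1≤o[ι] u , h , ι-inj (o-inj (sym (d-init (o (ι u)) (1≤o[ι] u) h)))

  o[ns] : ∀ j → j ≤ k → o (ns j) ≡ j
  o[ns] zero _ = o-self
  o[ns] (suc j) j<k = d-init (suc j) (s≤s z≤n) j<k

  keep-arc : ∀ j b → 1 ≤ j → j ≤ k → OC (t k) b (t (k + j)) ⇔ (k < o (ι b) × o (ι b) ≤ d (k + j))
  keep-arc j b 1≤j j≤k = subst (λ w → OC (t k) b (t (k + j)) ⇔ (w < o (ι b) × o (ι b) ≤ d (k + j))) dk≡k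
    (oc-lifted (t k) b (t (k + j)) (subst (_< d (k + j)) (sym dk≡k) (k<d[k+j] j 1≤j j≤k)))

  shift-arc : ∀ j b → 1 ≤ j → j ≤ k → CO (t (k + j)) b (t 1) ⇔ d (k + j) ≤ o (ι b)
  shift-arc j b 1≤j j≤k = co-lifted (t (k + j)) b (t 1) d1≡1 (≤-<-trans 1≤k (k<d[k+j] j 1≤j j≤k))

  -- An edge of U from the vertex at offset i ≤ k to an outer vertex ι b
  -- comes from an edge [t i, b] kept in place, or from an edge [t (i+1), b]
  -- moved to the previous vertex.
  KeptIn ShiftedIn : ℕ → Fin n → Set
  KeptIn i b = 1 ≤ i × o (ι b) ≤ d (k + i) × T (t i) b
  ShiftedIn i b = i < k × d (k + suc i) ≤ o (ι b) × T (t (suc i)) b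

  U-outward : ∀ X i b → o X ≡ i → i ≤ k → InflC X (ι b) → k < o (ι b) → KeptIn i b ⊎ ShiftedIn i b
  U-outward X i b oX i≤k (inj₂ (j , _ , j≤k , inj₁ (_ , e))) k<b =
    ⊥-elim (<⇒≱ k<b (subst (_≤ k) (sym (trans (cong o e) (o[ns] j j≤k))) j≤k))
  U-outward X i b oX i≤k (inj₂ (j , _ , _ , inj₂ (e , _))) k<b = ⊥-elim (ι≢σ b e)
  U-outward X i b oX i≤k (inj₁ (a' , b' , tab , inj₁ (inj₁ (¬a , _ , refl , _)))) k<b =
    ⊥-elim (¬a (offset≤k→InA a' (subst (_≤ k) (sym oX) i≤k)))
  U-outward X i b oX i≤k (inj₁ (a' , b' , tab , inj₁ (inj₂ (inj₁ (_ , ib , _ , e))))) k<b =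
    ⊥-elim (<⇒≱ k<b (subst (_≤ k) (cong o (sym e)) (InA→offset≤k b' ib)))
  U-outward X i b oX i≤k (inj₁ (a' , b' , tab , inj₁ (inj₂ (inj₂ (j , 1≤j , j≤k , refl , inj₁ (oc , refl , e)))))) k<b
    with ι-inj e | trans (sym oX) (d-init j 1≤j j≤k)
  ... | refl | refl = inj₁ (1≤j , proj₂ (to (keep-arc j b 1≤j j≤k) oc) , tab)
  U-outward X i b oX i≤k (inj₁ (a' , b' , tab , inj₁ (inj₂ (inj₂ (suc j , 1≤j , j<k , refl , inj₂ (co , refl , e)))))) k<b
    with ι-inj e | trans (sym oX) (o[ns] j (<⇒≤ j<k))
  ... | refl | refl = inj₂ (j<k , to (shift-arc (suc j) b 1≤j j<k) co , tab)
  U-outward X i b oX i≤k (inj₁ (a' , b' , tab , inj₂ (inj₁ (_ , ¬b , e , refl)))) k<b =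
    ⊥-elim (¬b (offset≤k→InA b' (subst (_≤ k) (sym oX) i≤k)))
  U-outward X i b oX i≤k (inj₁ (a' , b' , tab , inj₂ (inj₂ (inj₁ (ia , _ , e , _))))) k<b =
    ⊥-elim (<⇒≱ k<b (subst (_≤ k) (cong o (sym e)) (InA→offset≤k a' ia)))
  U-outward X i b oX i≤k (inj₁ (a' , b' , tab , inj₂ (inj₂ (inj₂ (j , 1≤j , j≤k , refl , inj₁ (_ , e , _)))))) k<b =
    ⊥-elim (<⇒≱ k<b (subst (_≤ k) (sym (trans (cong o e) (d-init j 1≤j j≤k))) j≤k))
  U-outward X i b oX i≤k (inj₁ (a' , b' , tab , inj₂ (inj₂ (inj₂ (suc j , 1≤j , j<k , refl , inj₂ (_ , e , _)))))) k<b =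
    ⊥-elim (<⇒≱ k<b (subst (_≤ k) (sym (trans (cong o e) (o[ns] j (<⇒≤ j<k)))) (<⇒≤ j<k)))

  open StarOffsets k 1≤k s p s0≡p (proj₁ star)

  ck≡k : c k ≡ k
  ck≡k = trans (cong o sk≡tk) dk≡k

  c-init : ∀ i → i ≤ k → c i ≡ i
  c-init = consecutive ck≡k

  U-sym : ∀ x y → U x y → U y x
  U-sym x y = cases→inflate y x ∘ inflC-sym x y ∘ inflate→cases x y

  open FlattenDescription k U s p c-init c-inc hiding (c)
  open FlattenCases k U s using (FlatOut; flat-sym)

  s≡ι[t] : ∀ i → 1 ≤ i → i ≤ k → s i ≡ ι (t i)
  s≡ι[t] i 1≤i i≤k = o-inj (trans (c-init i i≤k) (sym (d-init i 1≤i i≤k)))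

  U-outward-offsets : ∀ X i Y → o X ≡ i → i ≤ k → U X Y → k < o Y →
                      (1 ≤ i × o Y ≤ d (k + i)) ⊎ (i < k × d (k + suc i) ≤ o Y)
  U-outward-offsets X i Y oX i≤k uxy k<Y with ι-surj Y (≢base Y (≤-<-trans z≤n k<Y))
  ... | b , refl with U-outward X i b oX i≤k (inflate→cases X (ι b) uxy) k<Y
  ...   | inj₁ (1≤i , le , _) = inj₁ (1≤i , le)
  ...   | inj₂ (i<k , le , _) = inj₂ (i<k , le)

  -- The star edges [s i, s (k+i)] and [s i, s (k+i+1)] leave s i outward, so
  -- each is kept or shifted; this pins down the offsets c (k+i) = d (k+i).
  star-edge-offsets : ∀ i → 1 ≤ i → i ≤ k →
    c (k + i) ≤ d (k + i) ⊎ (i < k × d (k + suc i) ≤ c (k + i))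
  star-edge-offsets i 1≤i i≤k with U-outward-offsets (s i) i (s (k + i)) (c-init i i≤k) i≤k
    (star-edge k U s star i i≤k) (k<c[k+i] i 1≤i i≤k)
  ... | inj₁ (_ , le) = inj₁ le
  ... | inj₂ shifted = inj₂ shifted

  star-edge′-offsets : ∀ i → i < k →
    (1 ≤ i × c (k + suc i) ≤ d (k + i)) ⊎ d (k + suc i) ≤ c (k + suc i)
  star-edge′-offsets i i<k with U-outward-offsets (s i) i (s (k + suc i)) (c-init i (<⇒≤ i<k)) (<⇒≤ i<k)
    (star-edge′ k U s star U-sym i i<k) (k<c[k+i] (suc i) (s≤s z≤n) i<k)
  ... | inj₁ kept = inj₁ kept
  ... | inj₂ (_ , le) = inj₂ le

  c-step : ∀ m → suc m ≤ k → c (k + m) < c (k + suc m)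
  c-step m m<k = c-inc (k + m) (k + suc m) (+-monoʳ-< k ≤-refl) (k+i≤2k k (suc m) m<k)

  -- d (k+m+1) ≤ c (k+m) is impossible: the edge [s (m+1), s (k+m+1)] would
  -- have to be shifted, giving d (k+m+2) ≤ c (k+m+1), and so on until k.
  no-overtaking : ∀ f m → k ≡ suc m + f → d (k + suc m) ≤ c (k + m) → ⊥
  no-overtaking f m k≡ le with star-edge-offsets (suc m) (s≤s z≤n) (≤-trans (m≤m+n (suc m) f) (≤-reflexive (sym k≡)))
  ... | inj₁ kept = <-irrefl refl (≤-<-trans (≤-trans kept le) (c-step m (≤-trans (m≤m+n (suc m) f) (≤-reflexive (sym k≡)))))
  no-overtaking zero m k≡ le | inj₂ (m<k , _) = <-irrefl (trans (sym (+-identityʳ (suc m))) (sym k≡)) m<k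
  no-overtaking (suc f) m k≡ le | inj₂ (_ , le′) = no-overtaking f (suc m) (trans k≡ (+-suc (suc m) f)) le′

  c≡d-from-below : ∀ i → 1 ≤ i → i ≤ k → d (k + i) ≤ c (k + i) → c (k + i) ≡ d (k + i)
  c≡d-from-below i 1≤i i≤k d≤c with star-edge-offsets i 1≤i i≤k
  ... | inj₁ c≤d = ≤-antisym c≤d d≤c
  ... | inj₂ (i<k , le) = ⊥-elim (no-overtaking (k ∸ suc i) i (sym (m+[n∸m]≡n i<k)) le)

  star-is-crossing : ∀ i → 1 ≤ i → i ≤ k → c (k + i) ≡ d (k + i)
  star-is-crossing 1 _ 1≤k with star-edge′-offsets 0 1≤k
  ... | inj₁ (() , _)
  ... | inj₂ le = c≡d-from-below 1 ≤-refl 1≤k le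
  star-is-crossing (suc (suc i)) _ i<k = next (star-is-crossing (suc i) (s≤s z≤n) (<⇒≤ i<k))
    where
    next : c (k + suc i) ≡ d (k + suc i) → c (k + suc (suc i)) ≡ d (k + suc (suc i))
    next previous with star-edge′-offsets (suc i) i<k
    ... | inj₁ (_ , le) = ⊥-elim (<-irrefl refl (≤-<-trans (≤-trans le (≤-reflexive (sym previous))) (c-step (suc i) i<k)))
    ... | inj₂ le = c≡d-from-below (suc (suc i)) (s≤s z≤n) i<k le

  ns≡s : ∀ j → j ≤ k → ns j ≡ s j
  ns≡s zero _ = sym s0≡p
  ns≡s (suc j) j≤k = sym (s≡ι[t] (suc j) (s≤s z≤n) j≤k)

  flatten-inner : ∀ i j → 1 ≤ i → i ≤ k → 1 ≤ j → j ≤ k → T (t i) (t j) → FlatOut (ι (t i)) (ι (t j))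
  flatten-inner i j 1≤i i≤k 1≤j j≤k tij = subst₂ FlatOut (s≡ι[t] i 1≤i i≤k) (s≡ι[t] j 1≤j j≤k)
    (flat-inner i j 1≤i i≤k 1≤j j≤k (subst₂ U (sym (s≡ι[t] i 1≤i i≤k)) (sym (s≡ι[t] j 1≤j j≤k))
      (cases→inflate _ _ (inj₁ (t i , t j , tij , inj₁ (inj₂ (inj₁ ((i , 1≤i , i≤k , refl) , (j , 1≤j , j≤k , refl) , refl , refl))))))))

  flatten-outward : ∀ i b → 1 ≤ i → i ≤ k → k < o (ι b) → T (t i) b → FlatOut (ι (t i)) (ι b)
  flatten-outward i b 1≤i i≤k k<b tib with o (ι b) ≤? d (k + i)
  ... | yes b≤ = subst (λ w → FlatOut w (ι b)) (s≡ι[t] i 1≤i i≤k)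
      (flat-keep i (ι b) 1≤i i≤k k<b (subst (o (ι b) ≤_) (sym (star-is-crossing i 1≤i i≤k)) b≤)
        (subst (λ w → U w (ι b)) (sym (s≡ι[t] i 1≤i i≤k))
          (cases→inflate _ _ (inj₁ (t i , b , tib , inj₁ (inj₂ (inj₂ (i , 1≤i , i≤k , refl ,
            inj₁ (from (keep-arc i b 1≤i i≤k) (k<b , b≤) , refl , refl)))))))))
  flatten-outward (suc i) b 1≤i i<k k<b tib | no b≰ = subst (λ w → FlatOut w (ι b)) (s≡ι[t] (suc i) 1≤i i<k)
      (flat-shift i (ι b) i<k (subst (_≤ o (ι b)) (sym (star-is-crossing (suc i) 1≤i i<k)) ≤b)
        (subst (λ w → U w (ι b)) (ns≡s i (<⇒≤ i<k))
          (cases→inflate _ _ (inj₁ (t (suc i) , b , tib , inj₁ (inj₂ (inj₂ (suc i , 1≤i , i<k , refl ,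
            inj₂ (from (shift-arc (suc i) b 1≤i i<k) ≤b , refl , refl)))))))))
    where
    ≤b : d (k + suc i) ≤ o (ι b)
    ≤b = <⇒≤ (≰⇒> b≰)

  T→flattened : ∀ a b → T a b → FlatOut (ι a) (ι b)
  T→flattened a b tab with o (ι a) ≤? k | o (ι b) ≤? k
  ... | yes a≤k | yes b≤k with offset≤k→InA a a≤k | offset≤k→InA b b≤k
  ...   | (i , 1≤i , i≤k , refl) | (j , 1≤j , j≤k , refl) = flatten-inner i j 1≤i i≤k 1≤j j≤k tab
  T→flattened a b tab | yes a≤k | no b≰k with offset≤k→InA a a≤k
  ...   | (i , 1≤i , i≤k , refl) = flatten-outward i b 1≤i i≤k (≰⇒> b≰k) tab
  T→flattened a b tab | no a≰k | yes b≤k with offset≤k→InA b b≤k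
  ...   | (i , 1≤i , i≤k , refl) = flat-sym _ _ (flatten-outward i a 1≤i i≤k (≰⇒> a≰k) (T-sym _ _ tab))
  T→flattened a b tab | no a≰k | no b≰k = flat-outer (ι a) (ι b)
      (cases→inflate _ _ (inj₁ (a , b , tab , inj₁ (inj₁ (a≰k ∘ InA→offset≤k a , b≰k ∘ InA→offset≤k b , refl , refl)))))
      (≰⇒> a≰k) (≰⇒> b≰k)

  offset-of-ns : ∀ {Y} j → j ≤ k → Y ≡ ns j → o Y ≤ k
  offset-of-ns j j≤k e = subst (_≤ k) (sym (trans (cong o e) (o[ns] j j≤k))) j≤k

  offset-of-t : ∀ {Y} j → 1 ≤ j → j ≤ k → Y ≡ ι (t j) → o Y ≤ k
  offset-of-t j 1≤j j≤k e = subst (_≤ k) (sym (trans (cong o e) (d-init j 1≤j j≤k))) j≤k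

  U-outer : ∀ a b → InflC (ι a) (ι b) → k < o (ι a) → k < o (ι b) → T a b
  U-outer a b (inj₂ (_ , _ , _ , inj₁ (e , _))) _ _ = ⊥-elim (ι≢σ a e)
  U-outer a b (inj₂ (_ , _ , _ , inj₂ (e , _))) _ _ = ⊥-elim (ι≢σ b e)
  U-outer a b (inj₁ (a' , b' , tab , inj₁ (inj₁ (_ , _ , e₁ , e₂)))) _ _ = subst₂ T (sym (ι-inj e₁)) (sym (ι-inj e₂)) tab
  U-outer a b (inj₁ (a' , b' , tab , inj₁ (inj₂ (inj₁ (ia , _ , e₁ , _))))) k<a _ =
    ⊥-elim (<⇒≱ k<a (subst (_≤ k) (cong o (sym e₁)) (InA→offset≤k a' ia)))
  U-outer a b (inj₁ (a' , b' , tab , inj₁ (inj₂ (inj₂ (j , 1≤j , j≤k , refl , inj₁ (_ , e₁ , _)))))) k<a _ =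
    ⊥-elim (<⇒≱ k<a (offset-of-t j 1≤j j≤k e₁))
  U-outer a b (inj₁ (a' , b' , tab , inj₁ (inj₂ (inj₂ (suc j , _ , j<k , refl , inj₂ (_ , e₁ , _)))))) k<a _ =
    ⊥-elim (<⇒≱ k<a (offset-of-ns j (<⇒≤ j<k) e₁))
  U-outer a b (inj₁ (a' , b' , tab , inj₂ (inj₁ (_ , _ , e₁ , e₂)))) _ _ = T-sym _ _ (subst₂ T (sym (ι-inj e₁)) (sym (ι-inj e₂)) tab)
  U-outer a b (inj₁ (a' , b' , tab , inj₂ (inj₂ (inj₁ (ia , _ , e₁ , _))))) _ k<b =
    ⊥-elim (<⇒≱ k<b (subst (_≤ k) (cong o (sym e₁)) (InA→offset≤k a' ia)))
  U-outer a b (inj₁ (a' , b' , tab , inj₂ (inj₂ (inj₂ (j , 1≤j , j≤k , refl , inj₁ (_ , e₁ , _)))))) _ k<b =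
    ⊥-elim (<⇒≱ k<b (offset-of-t j 1≤j j≤k e₁))
  U-outer a b (inj₁ (a' , b' , tab , inj₂ (inj₂ (inj₂ (suc j , _ , j<k , refl , inj₂ (_ , e₁ , _)))))) _ k<b =
    ⊥-elim (<⇒≱ k<b (offset-of-ns j (<⇒≤ j<k) e₁))

  U-inner : ∀ i j → 1 ≤ i → i ≤ k → 1 ≤ j → j ≤ k → InflC (ι (t i)) (ι (t j)) → T (t i) (t j)
  U-inner i j 1≤i i≤k 1≤j j≤k (inj₂ (_ , _ , _ , inj₁ (e , _))) = ⊥-elim (ι≢σ _ e)
  U-inner i j 1≤i i≤k 1≤j j≤k (inj₂ (_ , _ , _ , inj₂ (e , _))) = ⊥-elim (ι≢σ _ e)
  U-inner i j 1≤i i≤k 1≤j j≤k (inj₁ (a' , b' , tab , inj₁ (inj₁ (¬a , _ , e₁ , _)))) = ⊥-elim (¬a (i , 1≤i , i≤k , sym (ι-inj e₁)))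
  U-inner i j 1≤i i≤k 1≤j j≤k (inj₁ (a' , b' , tab , inj₁ (inj₂ (inj₁ (_ , _ , e₁ , e₂))))) = subst₂ T (sym (ι-inj e₁)) (sym (ι-inj e₂)) tab
  U-inner i j 1≤i i≤k 1≤j j≤k (inj₁ (a' , b' , tab , inj₁ (inj₂ (inj₂ (j' , 1≤j' , j'≤k , refl , inj₁ (oc , _ , e₂)))))) =
    ⊥-elim (<⇒≱ (proj₁ (to (keep-arc j' b' 1≤j' j'≤k) oc)) (offset-of-t j 1≤j j≤k (sym e₂)))
  U-inner i j 1≤i i≤k 1≤j j≤k (inj₁ (a' , b' , tab , inj₁ (inj₂ (inj₂ (j' , 1≤j' , j'≤k , refl , inj₂ (co , _ , e₂)))))) =
    ⊥-elim (<⇒≱ (<-≤-trans (k<d[k+j] j' 1≤j' j'≤k) (to (shift-arc j' b' 1≤j' j'≤k) co)) (offset-of-t j 1≤j j≤k (sym e₂)))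
  U-inner i j 1≤i i≤k 1≤j j≤k (inj₁ (a' , b' , tab , inj₂ (inj₁ (¬a , _ , e₁ , _)))) = ⊥-elim (¬a (j , 1≤j , j≤k , sym (ι-inj e₁)))
  U-inner i j 1≤i i≤k 1≤j j≤k (inj₁ (a' , b' , tab , inj₂ (inj₂ (inj₁ (_ , _ , e₁ , e₂))))) = T-sym _ _ (subst₂ T (sym (ι-inj e₁)) (sym (ι-inj e₂)) tab)
  U-inner i j 1≤i i≤k 1≤j j≤k (inj₁ (a' , b' , tab , inj₂ (inj₂ (inj₂ (j' , 1≤j' , j'≤k , refl , inj₁ (oc , _ , e₂)))))) =
    ⊥-elim (<⇒≱ (proj₁ (to (keep-arc j' b' 1≤j' j'≤k) oc)) (offset-of-t i 1≤i i≤k (sym e₂)))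
  U-inner i j 1≤i i≤k 1≤j j≤k (inj₁ (a' , b' , tab , inj₂ (inj₂ (inj₂ (j' , 1≤j' , j'≤k , refl , inj₂ (co , _ , e₂)))))) =
    ⊥-elim (<⇒≱ (<-≤-trans (k<d[k+j] j' 1≤j' j'≤k) (to (shift-arc j' b' 1≤j' j'≤k) co)) (offset-of-t i 1≤i i≤k (sym e₂)))

  d-step-high : ∀ i → 1 ≤ i → i < k → d (k + i) < d (k + suc i)
  d-step-high i 1≤i i<k = d-inc (k + i) (k + suc i) (≤-trans 1≤i (m≤n+m i k)) (+-monoʳ-< k ≤-refl) (k+i≤2k k (suc i) i<k)

  -- Combining the kinds: kept and shifted edges of the flattening are the
  -- corresponding edges of T because the star coincides with the crossing.
  FlatEdge→T : ∀ a b → FlatEdge (ι a) (ι b) → T a b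
  FlatEdge→T a b (inj₁ (uab , k<a , k<b)) = U-outer a b (inflate→cases _ _ uab) k<a k<b
  FlatEdge→T a b (inj₂ (inj₁ (uab , _ , a≤k , _ , b≤k))) with offset≤k→InA a a≤k | offset≤k→InA b b≤k
  ... | (i , 1≤i , i≤k , refl) | (j , 1≤j , j≤k , refl) = U-inner i j 1≤i i≤k 1≤j j≤k (inflate→cases _ _ uab)
  FlatEdge→T a b (inj₂ (inj₂ (inj₁ (i , 1≤i , i≤k , e , k<b , b≤ , uab))))
    with U-outward (ι a) i b (offset-of-star e i≤k) i≤k (inflate→cases _ _ uab) k<b
  ... | inj₁ (_ , _ , tib) = subst (λ w → T w b) (sym (ι-inj (trans e (s≡ι[t] i 1≤i i≤k)))) tib
  ... | inj₂ (i<k , ≤b , _) = ⊥-elim (<-irrefl refl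
        (<-≤-trans (d-step-high i 1≤i i<k) (≤-trans ≤b (≤-trans b≤ (≤-reflexive (star-is-crossing i 1≤i i≤k))))))
  FlatEdge→T a b (inj₂ (inj₂ (inj₂ (i , i<k , e , ≤b , uib))))
    with U-outward (s i) i b (c-init i (<⇒≤ i<k)) (<⇒≤ i<k) (inflate→cases _ _ uib) (<-≤-trans (k<c[k+i] (suc i) (s≤s z≤n) i<k) ≤b)
  ... | inj₁ (1≤i , b≤ , _) = ⊥-elim (<-irrefl refl
        (<-≤-trans (d-step-high i 1≤i i<k) (≤-trans (≤-reflexive (sym (star-is-crossing (suc i) (s≤s z≤n) i<k))) (≤-trans ≤b b≤))))
  ... | inj₂ (_ , _ , tib) = subst (λ w → T w b) (sym (ι-inj (trans e (s≡ι[t] (suc i) (s≤s z≤n) i<k)))) tib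

  flattened→T : ∀ a b → FlatOut (ι a) (ι b) → T a b
  flattened→T a b fab with flat→FlatEdge (ι a) (ι b) fab
  ... | inj₁ e = FlatEdge→T a b e
  ... | inj₂ e = T-sym _ _ (FlatEdge→T b a e)

  inflate-then-flatten : ∀ u v → Flatten k U s u v ⇔ T u v
  inflate-then-flatten u v = subst (λ z → FlatOut (punchIn z u) (punchIn z v) ⇔ T u v) (sym s0≡p)
    (mk⇔ (flattened→T u v) (T→flattened u v))

theorem7p7 : (∀ (n k : ℕ) → 1 ≤ k → (T : EdgeSet (suc n)) → KTriangulation k T →
    (s : ℕ → Fin (suc n)) → IsKStarOf k T s → s k ≡ s 0 ⊕ k →
    (t : ℕ → Fin n) → (∀ j → 1 ≤ j → j ≤ 2 * k → punchIn (s 0) (t j) ≡ s j) →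
    ∀ u v → Inflate k (Flatten k T s) t (s 0) u v ⇔ T u v)
    ×
    (∀ (n k : ℕ) → 1 ≤ k → (T : EdgeSet n) → KTriangulation k T →
    (t : ℕ → Fin n) → IsConsecKCrossingOf k T t →
    (p : Fin (suc n)) → p ⊕ 1 ≡ punchIn p (t 1) →
    (s : ℕ → Fin (suc n)) → IsKStarOf k (Inflate k T t p) s →
    s 0 ≡ p → s k ≡ punchIn p (t k) →
    ∀ u v → Flatten k (Inflate k T t p) s u v ⇔ T u v)
theorem7p7 =
  (λ n k 1≤k T KT s star sk t t-lift → FlattenThenInflate.flatten-then-inflate 1≤k T KT s star sk t t-lift) ,
  (λ n k 1≤k T KT t crossing p p1 s star s0 sk → InflateThenFlatten.inflate-then-flatten 1≤k T KT t crossing p p1 s star s0 sk)
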